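{- (Multiparty cut) In the linear multirole logic LMRL over a set of roles $\mathcal{R}$, let $n\ge1$ and let $R_1,\dots,R_n\subseteq\mathcal{R}$ be such that the complements $\mathcal{R}\setminus R_1,\dots,\mathcal{R}\setminus R_n$ are pairwise disjoint and their union is $\mathcal{R}$. Then for all sequents $\Gamma_1,\dots,\Gamma_n$ and every formula $A$: if $\vdash\Gamma_i,[R_i]A$ is derivable for each $i=1,\dots,n$, then $\vdash\Gamma_1,\dots,\Gamma_n$ is derivable.
   Context: Fix a set $\mathcal{R}$ (the set of roles), possibly infinite. For $R\subseteq\mathcal{R}$ write $\overline{R}=\mathcal{R}\setminus R$; $R_1\uplus\cdots\uplus R_n$ denotes the union of pairwise disjoint sets. A filter on $\mathcal{R}$ is a set $\mathcal{F}$ of subsets of $\mathcal{R}$ with $\mathcal{R}\in\mathcal{F}$, upward closed under inclusion, and closed under binary intersection; an ultrafilter $\mathcal{U}$ is a filter such that for every $R\subseteq\mathcal{R}$, $R\in\mathcal{U}$ or $\overline{R}\in\mathcal{U}$. An endomorphism is any $f:\mathcal{R}\to\mathcal{R}$; $f^{ -1}(R)$ is the preimage. Terms $t$, atomic formulas $a$ are standard first-order. Formulas of LMRL: $A ::= a \mid \neg_f(A) \mid A_1\wedge_{\mathcal{U}}A_2 \mid A\supset_{f,\mathcal{U}}B \mid (!A)_{\mathcal{U}} \mid \forall_{\mathcal{U}}(\lambda x.A)$ ($f$ endomorphism, $\mathcal{U}$ ultrafilter); $A[x:=t]$ is substitution. An i-formula is $[R]A$ with $R\subseteq\mathcal{R}$;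 a sequent $\Gamma$ is a finite multiset of i-formulas, commas denoting multiset union. $?(\Gamma)$ denotes a sequent each of whose i-formulas has the form $[R'](!B)_{\mathcal{U}'}$ with $R'\notin\mathcal{U}'$. Derivable sequents are generated by: (Id) $\vdash[R_1]a,\dots,[R_n]a$ for atomic $a$, $n\ge1$, $R_1\uplus\cdots\uplus R_n=\mathcal{R}$; ($\neg$) from $\vdash\Gamma,[f^{ -1}(R)]A$ infer $\vdash\Gamma,[R]\neg_f(A)$; ($\supset$-neg) if $R\notin\mathcal{U}$, from $\vdash\Gamma,[f^{ -1}(R)]A,[R]B$ infer $\vdash\Gamma,[R](A\supset_{f,\mathcal{U}}B)$; ($\supset$-pos) if $R\in\mathcal{U}$, from $\vdash\Gamma_1,[f^{ -1}(R)]A$ and $\vdash\Gamma_2,[R]B$ infer $\vdash\Gamma_1,\Gamma_2,[R](A\supset_{f,\mathcal{U}}B)$; ($\wedge$-neg) if $R\notin\mathcal{U}$, from $\vdash\Gamma,[R]A$ or from $\vdash\Gamma,[R]B$ infer $\vdash\Gamma,[R](A\wedge_{\mathcal{U}}B)$; ($\wedge$-pos) if $R\in\mathcal{U}$, from $\vdash\Gamma,[R]A$ and $\vdash\Gamma,[R]B$ infer $\vdash\Gamma,[R](A\wedge_{\mathcal{U}}B)$; ($!$-pos) if $R\in\mathcal{U}$, from $\vdash ?(\Gamma),[R]A$ infer $\vdash ?(\Gamma),[R](!A)_{\mathcal{U}}$; ($!$-neg-weaken) if $R\notin\mathcal{U}$, from $\vdash\Gamma$ infer $\vdash\Gamma,[R](!A)_{\mathcal{U}}$;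 ($!$-neg-derelict) if $R\notin\mathcal{U}$, from $\vdash\Gamma,[R]A$ infer $\vdash\Gamma,[R](!A)_{\mathcal{U}}$; ($!$-neg-contract) if $R\notin\mathcal{U}$, from $\vdash\Gamma,[R](!A)_{\mathcal{U}},[R](!A)_{\mathcal{U}}$ infer $\vdash\Gamma,[R](!A)_{\mathcal{U}}$; ($\forall$-neg) if $R\notin\mathcal{U}$, from $\vdash\Gamma,[R]A[x:=t]$ infer $\vdash\Gamma,[R]\forall_{\mathcal{U}}(\lambda x.A)$; ($\forall$-pos) if $R\in\mathcal{U}$ and $x$ not free in $\Gamma$, from $\vdash\Gamma,[R]A$ infer $\vdash\Gamma,[R]\forall_{\mathcal{U}}(\lambda x.A)$. -}

module Defs where

open import Level using (0ℓ)
open import Data.Nat using (ℕ; zero; suc)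
open import Data.Fin using (Fin; zero; suc)
open import Data.Vec using (Vec; []; _∷_)
open import Data.List using (List; []; _∷_; _++_; [_]; map)
open import Data.List.Relation.Unary.All using (All)
open import Data.List.Relation.Binary.Permutation.Propositional using (_↭_)
open import Data.Product using (Σ; _×_; _,_)
open import Data.Sum using (_⊎_)
open import Data.Empty using (⊥)
open import Relation.Nullary using (¬_)
open import Relation.Binary.PropositionalEquality using (_≡_)
open import Relation.Unary using (Pred; _⊆_; _∩_; ∁; ∅) renaming (U to Univ)

-- Terms/formulas use (scoped) de Bruijn indices: `Formula k` has at most
-- k free variables.
module LMRL (Role : Set) (Fn : ℕ → Set) (Rl : ℕ → Set) where

  Subset : Set₁
  Subset = Pred Role 0ℓ

  preimage : (Role → Role) → Subset → Subset
  preimage f R = λ r → R (f r)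

  IsPartition : ∀ {n} → (Fin n → Subset) → Set
  IsPartition {n} Rs =
    (∀ (i j : Fin n) → ¬ (i ≡ j) → ∀ (r : Role) → Rs i r → Rs j r → ⊥)
    × (∀ (r : Role) → Σ (Fin n) (λ i → Rs i r))

  record Ultrafilter : Set₁ where
    field
      _∋_      : Subset → Set
      top      : _∋_ Univ
      up       : ∀ {R S} → R ⊆ S → _∋_ R → _∋_ S
      inter    : ∀ {R S} → _∋_ R → _∋_ S → _∋_ (R ∩ S)
      ultra    : ∀ R → _∋_ R ⊎ _∋_ (∁ R)
      proper   : ¬ (_∋_ ∅)
  open Ultrafilter public

  data Term (k : ℕ) : Set where
    var : Fin k → Term k
    fn  : ∀ {m} → Fn m → Vec (Term k) m → Term k

  data Atom (k : ℕ) : Set where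
    rel : ∀ {m} → Rl m → Vec (Term k) m → Atom k

  data Formula (k : ℕ) : Set₁ where
    atom : Atom k → Formula k
    neg  : (Role → Role) → Formula k → Formula k
    and  : Ultrafilter → Formula k → Formula k → Formula k
    imp  : (Role → Role) → Ultrafilter → Formula k → Formula k → Formula k
    bang : Ultrafilter → Formula k → Formula k
    all  : Ultrafilter → Formula (suc k) → Formula k

  mutual
    renT : ∀ {k j} → (Fin k → Fin j) → Term k → Term j
    renT ρ (var x) = var (ρ x)
    renT ρ (fn s ts) = fn s (renTs ρ ts)

    renTs : ∀ {k j m} → (Fin k → Fin j) → Vec (Term k) m → Vec (Term j) m
    renTs ρ [] = []
    renTs ρ (t ∷ ts) = renT ρ t ∷ renTs ρ ts

  mutual
    subT : ∀ {k j} → (Fin k → Term j) → Term k → Term j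
    subT σ (var x) = σ x
    subT σ (fn s ts) = fn s (subTs σ ts)

    subTs : ∀ {k j m} → (Fin k → Term j) → Vec (Term k) m → Vec (Term j) m
    subTs σ [] = []
    subTs σ (t ∷ ts) = subT σ t ∷ subTs σ ts

  liftR : ∀ {k j} → (Fin k → Fin j) → Fin (suc k) → Fin (suc j)
  liftR ρ zero = zero
  liftR ρ (suc x) = suc (ρ x)

  liftS : ∀ {k j} → (Fin k → Term j) → Fin (suc k) → Term (suc j)
  liftS σ zero = var zero
  liftS σ (suc x) = renT suc (σ x)

  renF : ∀ {k j} → (Fin k → Fin j) → Formula k → Formula j
  renF ρ (atom (rel p ts)) = atom (rel p (renTs ρ ts))
  renF ρ (neg f A) = neg f (renF ρ A)
  renF ρ (and U A B) = and U (renF ρ A) (renF ρ B)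
  renF ρ (imp f U A B) = imp f U (renF ρ A) (renF ρ B)
  renF ρ (bang U A) = bang U (renF ρ A)
  renF ρ (all U A) = all U (renF (liftR ρ) A)

  subF : ∀ {k j} → (Fin k → Term j) → Formula k → Formula j
  subF σ (atom (rel p ts)) = atom (rel p (subTs σ ts))
  subF σ (neg f A) = neg f (subF σ A)
  subF σ (and U A B) = and U (subF σ A) (subF σ B)
  subF σ (imp f U A B) = imp f U (subF σ A) (subF σ B)
  subF σ (bang U A) = bang U (subF σ A)
  subF σ (all U A) = all U (subF (liftS σ) A)

  inst : ∀ {k} → Formula (suc k) → Term k → Formula k
  inst A t = subF (λ { zero → t ; (suc x) → var x }) A

  -- i-formulas and sequents (multisets, represented by lists up to ↭)
  data IFormula (k : ℕ) : Set₁ where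
    ⟦_⟧_ : Subset → Formula k → IFormula k

  Sequent : ℕ → Set₁
  Sequent k = List (IFormula k)

  wkI : ∀ {k} → IFormula k → IFormula (suc k)
  wkI (⟦ R ⟧ A) = ⟦ R ⟧ renF suc A

  wkS : ∀ {k} → Sequent k → Sequent (suc k)
  wkS = map wkI

  data IsWhyNot {k : ℕ} : IFormula k → Set₁ where
    whyNot : ∀ {R U B} → ¬ (U ∋ R) → IsWhyNot (⟦ R ⟧ bang U B)

  tabulateL : ∀ {a} {A : Set a} {n} → (Fin n → A) → List A
  tabulateL {n = zero} f = []
  tabulateL {n = suc n} f = f zero ∷ tabulateL (λ i → f (suc i))

  infix 1 ⊢_
  infix 30 ⟦_⟧_
  data ⊢_ {k : ℕ} : Sequent k → Set₁ where
    exch   : ∀ {Γ Δ} → Γ ↭ Δ → ⊢ Γ → ⊢ Δ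
    Id     : ∀ {n} (a : Atom k) (Rs : Fin (suc n) → Subset) → IsPartition Rs
           → ⊢ tabulateL (λ i → ⟦ Rs i ⟧ atom a)
    negR   : ∀ {Γ R f A} → ⊢ Γ ++ [ ⟦ preimage f R ⟧ A ] → ⊢ Γ ++ [ ⟦ R ⟧ neg f A ]
    impN   : ∀ {Γ R f U A B} → ¬ (U ∋ R)
           → ⊢ Γ ++ (⟦ preimage f R ⟧ A) ∷ (⟦ R ⟧ B) ∷ []
           → ⊢ Γ ++ [ ⟦ R ⟧ imp f U A B ]
    impP   : ∀ {Γ₁ Γ₂ R f U A B} → U ∋ R
           → ⊢ Γ₁ ++ [ ⟦ preimage f R ⟧ A ] → ⊢ Γ₂ ++ [ ⟦ R ⟧ B ]
           → ⊢ (Γ₁ ++ Γ₂) ++ [ ⟦ R ⟧ imp f U A B ]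
    andN₁  : ∀ {Γ R U A B} → ¬ (U ∋ R) → ⊢ Γ ++ [ ⟦ R ⟧ A ] → ⊢ Γ ++ [ ⟦ R ⟧ and U A B ]
    andN₂  : ∀ {Γ R U A B} → ¬ (U ∋ R) → ⊢ Γ ++ [ ⟦ R ⟧ B ] → ⊢ Γ ++ [ ⟦ R ⟧ and U A B ]
    andP   : ∀ {Γ R U A B} → U ∋ R → ⊢ Γ ++ [ ⟦ R ⟧ A ] → ⊢ Γ ++ [ ⟦ R ⟧ B ]
           → ⊢ Γ ++ [ ⟦ R ⟧ and U A B ]
    bangP  : ∀ {Γ R U A} → All IsWhyNot Γ → U ∋ R → ⊢ Γ ++ [ ⟦ R ⟧ A ]
           → ⊢ Γ ++ [ ⟦ R ⟧ bang U A ]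
    bangW  : ∀ {Γ R U A} → ¬ (U ∋ R) → ⊢ Γ → ⊢ Γ ++ [ ⟦ R ⟧ bang U A ]
    bangD  : ∀ {Γ R U A} → ¬ (U ∋ R) → ⊢ Γ ++ [ ⟦ R ⟧ A ] → ⊢ Γ ++ [ ⟦ R ⟧ bang U A ]
    bangC  : ∀ {Γ R U A} → ¬ (U ∋ R)
           → ⊢ Γ ++ (⟦ R ⟧ bang U A) ∷ (⟦ R ⟧ bang U A) ∷ []
           → ⊢ Γ ++ [ ⟦ R ⟧ bang U A ]
    allN   : ∀ {Γ R U A} → ¬ (U ∋ R) → (t : Term k) → ⊢ Γ ++ [ ⟦ R ⟧ inst A t ]
           → ⊢ Γ ++ [ ⟦ R ⟧ all U A ]
    allP   : ∀ {Γ R U A} → U ∋ R → ⊢ wkS Γ ++ [ ⟦ R ⟧ A ]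
           → ⊢ Γ ++ [ ⟦ R ⟧ all U A ]

-- Two derivations of Γ₁, [R₁]A and Γ₂, [R₂]A whose role sets have disjoint complements merge into
-- one of Γ₁, Γ₂, [R₁ ∩ R₂]A, by induction on A. Each side is traced back, through the rules acting on
-- its context, to the step introducing the occurrence of A: for atoms these are two identity axioms,
-- which glue into one; otherwise the two introductions are combined by merging immediate subformulas.
-- An ultrafilter cannot omit both R₁ and R₂, so a negative rule on one side always meets a positive
-- one on the other. For !A with R₁ ∉ U ∋ R₂ the promoted side is instead substituted for every
-- occurrence on the other side, absorbing its weakenings, contractions and derelictions.
-- Merging Γᵢ, [Rᵢ]A one at a time gives Γ₁, …, Γₙ, [⋂ Rᵢ]A; as the complements cover all roles,
-- ⋂ Rᵢ is empty, and an i-formula holding for no role is erased by a final induction on derivations.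

module Submission where

open import Defs
open import Function using (_∘_)
open import Data.Empty using (⊥; ⊥-elim)
open import Data.Nat using (ℕ; zero; suc; _+_; _≤_; _⊔_)
open import Data.Nat.Properties using (≤-refl; ≤-pred; m⊔n≤o⇒m≤o; m⊔n≤o⇒n≤o)
open import Data.Fin using (Fin; zero; suc)
open import Data.Fin.Properties using (suc-injective)
open import Data.Vec using (Vec; []; _∷_)
open import Data.Product using (∃; _×_; _,_; proj₁; proj₂; swap)
open import Data.Sum using (_⊎_; inj₁; inj₂)
open import Data.List using (List; []; _∷_; _++_; [_]; map; length; concat; tabulate; lookup)
open import Data.List.Properties
  using (++-assoc; ++-identityʳ; length-++; length-map; map-++; ∷-injective; ++-conicalˡ; ++-conicalʳ; map-tabulate; tabulate-lookup)
open import Data.List.Membership.Propositional using (_∈_)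
open import Data.List.Membership.Propositional.Properties using (∈-++⁻; ∈-++⁺ʳ; ∈-∃++; ∈-lookup)
open import Data.List.Relation.Unary.All using (All; []; _∷_)
import Data.List.Relation.Unary.All as All
import Data.List.Relation.Unary.All.Properties as Allₚ
open import Data.List.Relation.Unary.Any using (Any; here; there; index)
import Data.List.Relation.Unary.Any.Properties as Anyₚ
open import Data.List.Relation.Unary.AllPairs using (AllPairs; []; _∷_)
import Data.List.Relation.Unary.AllPairs.Properties as AllPairs
open import Data.List.Relation.Binary.Permutation.Propositional
  using (_↭_; ↭-refl; ↭-sym; ↭-trans; ↭-prep; ↭-reflexive)
import Data.List.Relation.Binary.Permutation.Propositional as Perm
import Data.List.Relation.Binary.Permutation.Propositional.Properties as ↭
import Algebra.Solver.CommutativeMonoid as CommutativeMonoidSolver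
open import Algebra.Bundles.Raw using (RawMonoid)
open import Algebra.Solver.Monoid.Expression using (Expr; var; _⊕_)
open import Relation.Nullary using (¬_)
open import Relation.Unary using (∁; _∩_; _⊆_; _≐_; Empty)
open import Relation.Unary.Properties using (≐-refl)
open import Relation.Binary.PropositionalEquality
  using (_≡_; _≢_; _≗_; refl; sym; trans; cong; cong₂; subst; subst₂; module ≡-Reasoning)

-- Lists up to permutation

module ↭-Solver {a} {A : Set a} = CommutativeMonoidSolver (↭.++-commutativeMonoid {A = A})
open ↭-Solver using (prove)

v₀ : ∀ {c ℓ} {M : RawMonoid c ℓ} {n} → Expr M (suc n)
v₀ = var zero
v₁ : ∀ {c ℓ} {M : RawMonoid c ℓ} {n} → Expr M (suc (suc n))
v₁ = var (suc zero)
v₂ : ∀ {c ℓ} {M : RawMonoid c ℓ} {n} → Expr M (suc (suc (suc n)))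
v₂ = var (suc (suc zero))
v₃ : ∀ {c ℓ} {M : RawMonoid c ℓ} {n} → Expr M (suc (suc (suc (suc n))))
v₃ = var (suc (suc (suc zero)))
v₄ : ∀ {c ℓ} {M : RawMonoid c ℓ} {n} → Expr M (suc (suc (suc (suc (suc n)))))
v₄ = var (suc (suc (suc (suc zero))))

infixr 2 _⟫_
_⟫_ : ∀ {a} {A : Set a} {xs ys zs : List A} → xs ↭ ys → ys ↭ zs → xs ↭ zs
_⟫_ = ↭-trans

module _ {a} {A : Set a} where

  copies : List A → ℕ → List A
  copies E zero = []
  copies E (suc n) = E ++ copies E n

  copies-+ : ∀ E m n → copies E (m + n) ≡ copies E m ++ copies E n
  copies-+ E zero n = refl
  copies-+ E (suc m) n = trans (cong (E ++_) (copies-+ E m n)) (sym (++-assoc E (copies E m) (copies E n)))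

  copies-[] : ∀ n → copies [] n ≡ []
  copies-[] zero = refl
  copies-[] (suc n) = copies-[] n

  copies⁺ : ∀ {p} {P : A → Set p} {E} → All P E → ∀ n → All P (copies E n)
  copies⁺ ps zero = []
  copies⁺ ps (suc n) = Allₚ.++⁺ ps (copies⁺ ps n)

  ∈⇒↭∷ : ∀ {x : A} {xs} → x ∈ xs → ∃ λ ys → xs ↭ x ∷ ys
  ∈⇒↭∷ {x} x∈xs with ys , zs , refl ← ∈-∃++ x∈xs = ys ++ zs , ↭.shift x ys zs

  ++-swapʳ : (xs ys zs : List A) → (xs ++ ys) ++ zs ↭ (xs ++ zs) ++ ys
  ++-swapʳ xs ys zs = prove 3 ((v₀ ⊕ v₁) ⊕ v₂) ((v₀ ⊕ v₂) ⊕ v₁) (xs ∷ ys ∷ zs ∷ [])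

  ∷ʳ↭∷ : (x : A) (xs : List A) → xs ++ [ x ] ↭ x ∷ xs
  ∷ʳ↭∷ x xs = ↭-sym (↭.∷↭∷ʳ x xs)

  split-∷ʳ : ∀ {Δ Γ Θ : List A} {p} → Δ ++ [ p ] ↭ Γ ++ Θ →
    (∃ λ Θ' → Θ ↭ p ∷ Θ' × Δ ↭ Γ ++ Θ') ⊎ (∃ λ Γ' → Γ ↭ p ∷ Γ' × Δ ↭ Γ' ++ Θ)
  split-∷ʳ {Δ} {Γ} {Θ} {p} q with ∈-++⁻ Γ (↭.∈-resp-↭ q (∈-++⁺ʳ Δ (here refl)))
  ... | inj₁ p∈Γ with Γ' , qΓ ← ∈⇒↭∷ p∈Γ =
    inj₂ (Γ' , qΓ , ↭.drop-∷ (↭-sym (∷ʳ↭∷ p Δ) ⟫ q ⟫ ↭.++⁺ʳ Θ qΓ))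
  ... | inj₂ p∈Θ with Θ' , qΘ ← ∈⇒↭∷ p∈Θ =
    inj₁ (Θ' , qΘ , ↭.drop-∷ (↭-sym (∷ʳ↭∷ p Δ) ⟫ q ⟫ ↭.++⁺ˡ Γ qΘ ⟫ ↭.shift p Γ Θ'))

  split-++ : ∀ (Γa Γb Γ Θ : List A) → Γa ++ Γb ↭ Γ ++ Θ →
    ∃ λ Θa → ∃ λ Θb → ∃ λ Γa' → ∃ λ Γb' →
      (Θ ↭ Θa ++ Θb) × (Γa ↭ Γa' ++ Θa) × (Γb ↭ Γb' ++ Θb) × (Γ ↭ Γa' ++ Γb')
  split-++ Γa Γb Γ [] q =
    [] , [] , Γa , Γb , ↭-refl , ↭-reflexive (sym (++-identityʳ Γa)) , ↭-reflexive (sym (++-identityʳ Γb)) ,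
    (↭-reflexive (sym (++-identityʳ Γ)) ⟫ ↭-sym q)
  split-++ Γa Γb Γ (t ∷ Θ) q with ∈-++⁻ Γa (↭.∈-resp-↭ (↭-sym q) (∈-++⁺ʳ Γ (here refl)))
  ... | inj₁ t∈Γa
    with Γa₁ , qa ← ∈⇒↭∷ t∈Γa
    with Θa , Θb , Γa' , Γb' , r₁ , r₂ , r₃ , r₄
           ← split-++ Γa₁ Γb Γ Θ (↭.drop-∷ (↭-sym (↭.++⁺ʳ Γb qa) ⟫ q ⟫ ↭.shift t Γ Θ)) =
    t ∷ Θa , Θb , Γa' , Γb' , ↭-prep t r₁ , (qa ⟫ ↭-prep t r₂ ⟫ ↭-sym (↭.shift t Γa' Θa)) , r₃ , r₄
  ... | inj₂ t∈Γb
    with Γb₁ , qb ← ∈⇒↭∷ t∈Γb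
    with Θa , Θb , Γa' , Γb' , r₁ , r₂ , r₃ , r₄
           ← split-++ Γa Γb₁ Γ Θ (↭.drop-∷ (↭-sym (↭.++⁺ˡ Γa qb ⟫ ↭.shift t Γa Γb₁) ⟫ q ⟫ ↭.shift t Γ Θ)) =
    Θa , t ∷ Θb , Γa' , Γb' , (↭-prep t r₁ ⟫ ↭-sym (↭.shift t Θa Θb)) , r₂ ,
    (qb ⟫ ↭-prep t r₃ ⟫ ↭-sym (↭.shift t Γb' Θb)) , r₄

map-copies : ∀ {a b} {A : Set a} {B : Set b} (f : A → B) E n → map f (copies E n) ≡ copies (map f E) n
map-copies f E zero = refl
map-copies f E (suc n) = trans (map-++ f E (copies E n)) (cong (map f E ++_) (map-copies f E n))

map-≡-++⁻ : ∀ {a b} {A : Set a} {B : Set b} (f : A → B) xs ys zs → map f xs ≡ ys ++ zs →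
  ∃ λ xs₁ → ∃ λ xs₂ → xs ≡ xs₁ ++ xs₂ × ys ≡ map f xs₁ × zs ≡ map f xs₂
map-≡-++⁻ f xs [] zs e = [] , xs , refl , refl , sym e
map-≡-++⁻ f (x ∷ xs) (y ∷ ys) zs e with ∷-injective e
... | refl , e' with xs₁ , xs₂ , refl , refl , refl ← map-≡-++⁻ f xs ys zs e' = x ∷ xs₁ , xs₂ , refl , refl , refl

AllPairs-++⁻ : ∀ {a ℓ} {A : Set a} {R : A → A → Set ℓ} xs {ys} → AllPairs R (xs ++ ys) →
  AllPairs R xs × AllPairs R ys × All (λ x → All (R x) ys) xs
AllPairs-++⁻ [] a = [] , a , []
AllPairs-++⁻ (x ∷ xs) (h ∷ a) with a₁ , a₂ , c ← AllPairs-++⁻ xs a =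
  Allₚ.++⁻ˡ xs h ∷ a₁ , a₂ , Allₚ.++⁻ʳ xs h ∷ c

module MultipartyCut (Role : Set) (Fn Rl : ℕ → Set) where
  open LMRL Role Fn Rl

  -- Substitution

  mutual
    subT-cong : ∀ {k j} {σ τ : Fin k → Term j} → σ ≗ τ → ∀ t → subT σ t ≡ subT τ t
    subT-cong e (var x) = e x
    subT-cong e (fn s ts) = cong (fn s) (subTs-cong e ts)

    subTs-cong : ∀ {k j m} {σ τ : Fin k → Term j} → σ ≗ τ → (ts : Vec (Term k) m) → subTs σ ts ≡ subTs τ ts
    subTs-cong e [] = refl
    subTs-cong e (t ∷ ts) = cong₂ _∷_ (subT-cong e t) (subTs-cong e ts)

  mutual
    renT-renT : ∀ {k j i} (ρ : Fin j → Fin i) (τ : Fin k → Fin j) t → renT ρ (renT τ t) ≡ renT (ρ ∘ τ) t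
    renT-renT ρ τ (var x) = refl
    renT-renT ρ τ (fn s ts) = cong (fn s) (renTs-renTs ρ τ ts)

    renTs-renTs : ∀ {k j i m} (ρ : Fin j → Fin i) (τ : Fin k → Fin j) (ts : Vec (Term k) m)
                → renTs ρ (renTs τ ts) ≡ renTs (ρ ∘ τ) ts
    renTs-renTs ρ τ [] = refl
    renTs-renTs ρ τ (t ∷ ts) = cong₂ _∷_ (renT-renT ρ τ t) (renTs-renTs ρ τ ts)

  mutual
    subT-renT : ∀ {k j i} (σ : Fin j → Term i) (τ : Fin k → Fin j) t → subT σ (renT τ t) ≡ subT (σ ∘ τ) t
    subT-renT σ τ (var x) = refl
    subT-renT σ τ (fn s ts) = cong (fn s) (subTs-renTs σ τ ts)

    subTs-renTs : ∀ {k j i m} (σ : Fin j → Term i) (τ : Fin k → Fin j) (ts : Vec (Term k) m)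
                → subTs σ (renTs τ ts) ≡ subTs (σ ∘ τ) ts
    subTs-renTs σ τ [] = refl
    subTs-renTs σ τ (t ∷ ts) = cong₂ _∷_ (subT-renT σ τ t) (subTs-renTs σ τ ts)

  mutual
    renT-subT : ∀ {k j i} (ρ : Fin j → Fin i) (σ : Fin k → Term j) t → renT ρ (subT σ t) ≡ subT (renT ρ ∘ σ) t
    renT-subT ρ σ (var x) = refl
    renT-subT ρ σ (fn s ts) = cong (fn s) (renTs-subTs ρ σ ts)

    renTs-subTs : ∀ {k j i m} (ρ : Fin j → Fin i) (σ : Fin k → Term j) (ts : Vec (Term k) m)
                → renTs ρ (subTs σ ts) ≡ subTs (renT ρ ∘ σ) ts
    renTs-subTs ρ σ [] = refl
    renTs-subTs ρ σ (t ∷ ts) = cong₂ _∷_ (renT-subT ρ σ t) (renTs-subTs ρ σ ts)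

  mutual
    subT-subT : ∀ {k j i} (ρ : Fin j → Term i) (σ : Fin k → Term j) t → subT ρ (subT σ t) ≡ subT (subT ρ ∘ σ) t
    subT-subT ρ σ (var x) = refl
    subT-subT ρ σ (fn s ts) = cong (fn s) (subTs-subTs ρ σ ts)

    subTs-subTs : ∀ {k j i m} (ρ : Fin j → Term i) (σ : Fin k → Term j) (ts : Vec (Term k) m)
                → subTs ρ (subTs σ ts) ≡ subTs (subT ρ ∘ σ) ts
    subTs-subTs ρ σ [] = refl
    subTs-subTs ρ σ (t ∷ ts) = cong₂ _∷_ (subT-subT ρ σ t) (subTs-subTs ρ σ ts)

  mutual
    subT-var : ∀ {k} (t : Term k) → subT var t ≡ t
    subT-var (var x) = refl
    subT-var (fn s ts) = cong (fn s) (subTs-var ts)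

    subTs-var : ∀ {k m} (ts : Vec (Term k) m) → subTs var ts ≡ ts
    subTs-var [] = refl
    subTs-var (t ∷ ts) = cong₂ _∷_ (subT-var t) (subTs-var ts)

  subF-cong : ∀ {k j} {σ τ : Fin k → Term j} → σ ≗ τ → ∀ A → subF σ A ≡ subF τ A
  subF-cong e (atom (rel p ts)) = cong (atom ∘ rel p) (subTs-cong e ts)
  subF-cong e (neg f A) = cong (neg f) (subF-cong e A)
  subF-cong e (and U A B) = cong₂ (and U) (subF-cong e A) (subF-cong e B)
  subF-cong e (imp f U A B) = cong₂ (imp f U) (subF-cong e A) (subF-cong e B)
  subF-cong e (bang U A) = cong (bang U) (subF-cong e A)
  subF-cong {σ = σ} {τ} e (all U A) = cong (all U) (subF-cong e↑ A)
    where
      e↑ : liftS σ ≗ liftS τ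
      e↑ zero = refl
      e↑ (suc x) = cong (renT suc) (e x)

  subF-renF : ∀ {k j i} (σ : Fin j → Term i) (τ : Fin k → Fin j) A → subF σ (renF τ A) ≡ subF (σ ∘ τ) A
  subF-renF σ τ (atom (rel p ts)) = cong (atom ∘ rel p) (subTs-renTs σ τ ts)
  subF-renF σ τ (neg f A) = cong (neg f) (subF-renF σ τ A)
  subF-renF σ τ (and U A B) = cong₂ (and U) (subF-renF σ τ A) (subF-renF σ τ B)
  subF-renF σ τ (imp f U A B) = cong₂ (imp f U) (subF-renF σ τ A) (subF-renF σ τ B)
  subF-renF σ τ (bang U A) = cong (bang U) (subF-renF σ τ A)
  subF-renF σ τ (all U A) = cong (all U) (trans (subF-renF (liftS σ) (liftR τ) A) (subF-cong e A))
    where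
      e : liftS σ ∘ liftR τ ≗ liftS (σ ∘ τ)
      e zero = refl
      e (suc x) = refl

  renF-subF : ∀ {k j i} (ρ : Fin j → Fin i) (σ : Fin k → Term j) A → renF ρ (subF σ A) ≡ subF (renT ρ ∘ σ) A
  renF-subF ρ σ (atom (rel p ts)) = cong (atom ∘ rel p) (renTs-subTs ρ σ ts)
  renF-subF ρ σ (neg f A) = cong (neg f) (renF-subF ρ σ A)
  renF-subF ρ σ (and U A B) = cong₂ (and U) (renF-subF ρ σ A) (renF-subF ρ σ B)
  renF-subF ρ σ (imp f U A B) = cong₂ (imp f U) (renF-subF ρ σ A) (renF-subF ρ σ B)
  renF-subF ρ σ (bang U A) = cong (bang U) (renF-subF ρ σ A)
  renF-subF ρ σ (all U A) = cong (all U) (trans (renF-subF (liftR ρ) (liftS σ) A) (subF-cong e A))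
    where
      e : renT (liftR ρ) ∘ liftS σ ≗ liftS (renT ρ ∘ σ)
      e zero = refl
      e (suc x) = trans (renT-renT (liftR ρ) suc (σ x)) (sym (renT-renT suc ρ (σ x)))

  subF-subF : ∀ {k j i} (ρ : Fin j → Term i) (σ : Fin k → Term j) A → subF ρ (subF σ A) ≡ subF (subT ρ ∘ σ) A
  subF-subF ρ σ (atom (rel p ts)) = cong (atom ∘ rel p) (subTs-subTs ρ σ ts)
  subF-subF ρ σ (neg f A) = cong (neg f) (subF-subF ρ σ A)
  subF-subF ρ σ (and U A B) = cong₂ (and U) (subF-subF ρ σ A) (subF-subF ρ σ B)
  subF-subF ρ σ (imp f U A B) = cong₂ (imp f U) (subF-subF ρ σ A) (subF-subF ρ σ B)
  subF-subF ρ σ (bang U A) = cong (bang U) (subF-subF ρ σ A)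
  subF-subF ρ σ (all U A) = cong (all U) (trans (subF-subF (liftS ρ) (liftS σ) A) (subF-cong e A))
    where
      e : subT (liftS ρ) ∘ liftS σ ≗ liftS (subT ρ ∘ σ)
      e zero = refl
      e (suc x) = trans (subT-renT (liftS ρ) suc (σ x)) (sym (renT-subT suc ρ (σ x)))

  subF-var : ∀ {k} (A : Formula k) → subF var A ≡ A
  subF-var (atom (rel p ts)) = cong (atom ∘ rel p) (subTs-var ts)
  subF-var (neg f A) = cong (neg f) (subF-var A)
  subF-var (and U A B) = cong₂ (and U) (subF-var A) (subF-var B)
  subF-var (imp f U A B) = cong₂ (imp f U) (subF-var A) (subF-var B)
  subF-var (bang U A) = cong (bang U) (subF-var A)
  subF-var (all U A) = cong (all U) (trans (subF-cong e A) (subF-var A))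
    where
      e : liftS var ≗ var
      e zero = refl
      e (suc x) = refl

  instσ : ∀ {k} → Term k → Fin (suc k) → Term k
  instσ t zero = t
  instσ t (suc x) = var x

  inst-instσ : ∀ {k} (A : Formula (suc k)) t → inst A t ≡ subF (instσ t) A
  inst-instσ A t = subF-cong (λ { zero → refl ; (suc x) → refl }) A

  subF-inst : ∀ {k j} (σ : Fin k → Term j) A t → subF σ (inst A t) ≡ inst (subF (liftS σ) A) (subT σ t)
  subF-inst σ A t = begin
    subF σ (inst A t)                                 ≡⟨ cong (subF σ) (inst-instσ A t) ⟩
    subF σ (subF (instσ t) A)                         ≡⟨ subF-subF σ (instσ t) A ⟩
    subF (subT σ ∘ instσ t) A                         ≡⟨ subF-cong e A ⟩
    subF (subT (instσ (subT σ t)) ∘ liftS σ) A        ≡⟨ subF-subF (instσ (subT σ t)) (liftS σ) A ⟨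
    subF (instσ (subT σ t)) (subF (liftS σ) A)        ≡⟨ inst-instσ (subF (liftS σ) A) (subT σ t) ⟨
    inst (subF (liftS σ) A) (subT σ t)                ∎
    where
      open ≡-Reasoning
      e : subT σ ∘ instσ t ≗ subT (instσ (subT σ t)) ∘ liftS σ
      e zero = refl
      e (suc x) = trans (sym (subT-var (σ x))) (sym (subT-renT _ suc (σ x)))

  subF-liftS-wk : ∀ {k j} (σ : Fin k → Term j) A → subF (liftS σ) (renF suc A) ≡ renF suc (subF σ A)
  subF-liftS-wk σ A = trans (subF-renF (liftS σ) suc A) (sym (renF-subF suc σ A))

  size : ∀ {k} → Formula k → ℕ
  size (atom _) = 1
  size (neg f A) = suc (size A)
  size (and U A B) = suc (size A ⊔ size B)
  size (imp f U A B) = suc (size A ⊔ size B)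
  size (bang U A) = suc (size A)
  size (all U A) = suc (size A)

  size-subF : ∀ {k j} (σ : Fin k → Term j) A → size (subF σ A) ≡ size A
  size-subF σ (atom (rel p ts)) = refl
  size-subF σ (neg f A) = cong suc (size-subF σ A)
  size-subF σ (and U A B) = cong₂ (λ a b → suc (a ⊔ b)) (size-subF σ A) (size-subF σ B)
  size-subF σ (imp f U A B) = cong₂ (λ a b → suc (a ⊔ b)) (size-subF σ A) (size-subF σ B)
  size-subF σ (bang U A) = cong suc (size-subF σ A)
  size-subF σ (all U A) = cong suc (size-subF (liftS σ) A)

  tabulateL≡tabulate : ∀ {a} {A : Set a} {n} (f : Fin n → A) → tabulateL f ≡ tabulate f
  tabulateL≡tabulate {n = zero} f = refl
  tabulateL≡tabulate {n = suc n} f = cong (f zero ∷_) (tabulateL≡tabulate (f ∘ suc))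

  map-tabulateL : ∀ {a b} {A : Set a} {B : Set b} {n} (f : A → B) (g : Fin n → A)
                → map f (tabulateL g) ≡ tabulateL (f ∘ g)
  map-tabulateL f g = begin
    map f (tabulateL g)  ≡⟨ cong (map f) (tabulateL≡tabulate g) ⟩
    map f (tabulate g)   ≡⟨ map-tabulate g f ⟩
    tabulate (f ∘ g)     ≡⟨ tabulateL≡tabulate (f ∘ g) ⟨
    tabulateL (f ∘ g)    ∎
    where open ≡-Reasoning

  subI : ∀ {k j} → (Fin k → Term j) → IFormula k → IFormula j
  subI σ (⟦ R ⟧ A) = ⟦ R ⟧ subF σ A

  subS : ∀ {k j} → (Fin k → Term j) → Sequent k → Sequent j
  subS σ = map (subI σ)

  subS-++ : ∀ {k j} (σ : Fin k → Term j) Γ Δ → subS σ (Γ ++ Δ) ≡ subS σ Γ ++ subS σ Δ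
  subS-++ σ = map-++ (subI σ)

  subI-var : ∀ {k} (x : IFormula k) → subI var x ≡ x
  subI-var (⟦ R ⟧ A) = cong (⟦ R ⟧_) (subF-var A)

  subS-var : ∀ {k} (Γ : Sequent k) → subS var Γ ≡ Γ
  subS-var [] = refl
  subS-var (x ∷ Γ) = cong₂ _∷_ (subI-var x) (subS-var Γ)

  wkI-subI : ∀ {k j} (σ : Fin k → Term j) x → wkI (subI σ x) ≡ subI (renT suc ∘ σ) x
  wkI-subI σ (⟦ R ⟧ A) = cong (⟦ R ⟧_) (renF-subF suc σ A)

  wkS-subS : ∀ {k j} (σ : Fin k → Term j) Γ → wkS (subS σ Γ) ≡ subS (renT suc ∘ σ) Γ
  wkS-subS σ [] = refl
  wkS-subS σ (x ∷ Γ) = cong₂ _∷_ (wkI-subI σ x) (wkS-subS σ Γ)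

  subS-liftS-wkS : ∀ {k j} (σ : Fin k → Term j) Γ → subS (liftS σ) (wkS Γ) ≡ wkS (subS σ Γ)
  subS-liftS-wkS σ [] = refl
  subS-liftS-wkS σ ((⟦ R ⟧ A) ∷ Γ) = cong₂ _∷_ (cong (⟦ R ⟧_) (subF-liftS-wk σ A)) (subS-liftS-wkS σ Γ)

  subS-instσ-wkS : ∀ {k} (t : Term k) Γ → subS (instσ t) (wkS Γ) ≡ Γ
  subS-instσ-wkS t [] = refl
  subS-instσ-wkS t ((⟦ R ⟧ A) ∷ Γ) =
    cong₂ _∷_ (cong (⟦ R ⟧_) (trans (subF-renF (instσ t) suc A) (subF-var A))) (subS-instσ-wkS t Γ)

  subS-WhyNot : ∀ {k j} (σ : Fin k → Term j) {Γ} → All IsWhyNot Γ → All IsWhyNot (subS σ Γ)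
  subS-WhyNot σ [] = []
  subS-WhyNot σ (whyNot R∉U ∷ ws) = whyNot R∉U ∷ subS-WhyNot σ ws

  WhyNot-subI⁻ : ∀ {k j} (σ : Fin k → Term j) x → IsWhyNot (subI σ x) → IsWhyNot x
  WhyNot-subI⁻ σ (⟦ R ⟧ atom (rel p ts)) ()
  WhyNot-subI⁻ σ (⟦ R ⟧ neg f A) ()
  WhyNot-subI⁻ σ (⟦ R ⟧ and U A B) ()
  WhyNot-subI⁻ σ (⟦ R ⟧ imp f U A B) ()
  WhyNot-subI⁻ σ (⟦ R ⟧ bang U A) (whyNot R∉U) = whyNot R∉U
  WhyNot-subI⁻ σ (⟦ R ⟧ all U A) ()

  ⊢-subS-++⁺ : ∀ {k j} (σ : Fin k → Term j) Γ {Δ} → ⊢ subS σ Γ ++ subS σ Δ → ⊢ subS σ (Γ ++ Δ)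
  ⊢-subS-++⁺ σ Γ = subst ⊢_ (sym (subS-++ σ Γ _))

  ⊢-subS-++⁻ : ∀ {k j} (σ : Fin k → Term j) Γ {Δ} → ⊢ subS σ (Γ ++ Δ) → ⊢ subS σ Γ ++ subS σ Δ
  ⊢-subS-++⁻ σ Γ = subst ⊢_ (subS-++ σ Γ _)

  ⊢-sub : ∀ {k j} (σ : Fin k → Term j) {Δ} → ⊢ Δ → ⊢ subS σ Δ
  ⊢-sub σ (exch p d) = exch (↭.map⁺ (subI σ) p) (⊢-sub σ d)
  ⊢-sub σ (Id (rel p ts) Rs part) =
    subst ⊢_ (sym (map-tabulateL (subI σ) (λ i → ⟦ Rs i ⟧ atom (rel p ts)))) (Id (rel p (subTs σ ts)) Rs part)
  ⊢-sub σ (negR {Γ} d) = ⊢-subS-++⁺ σ Γ (negR (⊢-subS-++⁻ σ Γ (⊢-sub σ d)))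
  ⊢-sub σ (impN {Γ} R∉U d) = ⊢-subS-++⁺ σ Γ (impN R∉U (⊢-subS-++⁻ σ Γ (⊢-sub σ d)))
  ⊢-sub σ (impP {Γ₁} {Γ₂} R∈U d e) = subst ⊢_ eq
    (impP R∈U (⊢-subS-++⁻ σ Γ₁ (⊢-sub σ d)) (⊢-subS-++⁻ σ Γ₂ (⊢-sub σ e)))
    where
      eq : (subS σ Γ₁ ++ subS σ Γ₂) ++ _ ≡ subS σ ((Γ₁ ++ Γ₂) ++ _)
      eq = sym (trans (subS-++ σ (Γ₁ ++ Γ₂) _) (cong (_++ _) (subS-++ σ Γ₁ Γ₂)))
  ⊢-sub σ (andN₁ {Γ} R∉U d) = ⊢-subS-++⁺ σ Γ (andN₁ R∉U (⊢-subS-++⁻ σ Γ (⊢-sub σ d)))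
  ⊢-sub σ (andN₂ {Γ} R∉U d) = ⊢-subS-++⁺ σ Γ (andN₂ R∉U (⊢-subS-++⁻ σ Γ (⊢-sub σ d)))
  ⊢-sub σ (andP {Γ} R∈U d e) =
    ⊢-subS-++⁺ σ Γ (andP R∈U (⊢-subS-++⁻ σ Γ (⊢-sub σ d)) (⊢-subS-++⁻ σ Γ (⊢-sub σ e)))
  ⊢-sub σ (bangP {Γ} ws R∈U d) = ⊢-subS-++⁺ σ Γ (bangP (subS-WhyNot σ ws) R∈U (⊢-subS-++⁻ σ Γ (⊢-sub σ d)))
  ⊢-sub σ (bangW {Γ} R∉U d) = ⊢-subS-++⁺ σ Γ (bangW R∉U (⊢-sub σ d))
  ⊢-sub σ (bangD {Γ} R∉U d) = ⊢-subS-++⁺ σ Γ (bangD R∉U (⊢-subS-++⁻ σ Γ (⊢-sub σ d)))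
  ⊢-sub σ (bangC {Γ} R∉U d) = ⊢-subS-++⁺ σ Γ (bangC R∉U (⊢-subS-++⁻ σ Γ (⊢-sub σ d)))
  ⊢-sub σ (allN {Γ} {R} {U} {A} R∉U t d) = ⊢-subS-++⁺ σ Γ (allN R∉U (subT σ t)
    (subst (λ B → ⊢ subS σ Γ ++ [ ⟦ R ⟧ B ]) (subF-inst σ A t) (⊢-subS-++⁻ σ Γ (⊢-sub σ d))))
  ⊢-sub σ (allP {Γ} {R} {U} {A} R∈U d) = ⊢-subS-++⁺ σ Γ (allP R∈U
    (subst (λ Δ → ⊢ Δ ++ [ ⟦ R ⟧ subF (liftS σ) A ]) (subS-liftS-wkS σ Γ)
      (⊢-subS-++⁻ (liftS σ) (wkS Γ) (⊢-sub (liftS σ) d))))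

  -- Replacing occurrences in derivations

  wkσ : ∀ {k j} → (Fin k → Term j) → Fin k → Term (suc j)
  wkσ σ = renT suc ∘ σ

  -- The premises of a derivation of Γ ++ [ x ] whose last rule, named by the constructor, introduces x.
  data Introduced {j} : Sequent j → IFormula j → Set₁ where
    negR  : ∀ {Γ R f A} → ⊢ Γ ++ [ ⟦ preimage f R ⟧ A ] → Introduced Γ (⟦ R ⟧ neg f A)
    impN  : ∀ {Γ R f U A B} → ¬ (U ∋ R) → ⊢ Γ ++ (⟦ preimage f R ⟧ A) ∷ (⟦ R ⟧ B) ∷ []
          → Introduced Γ (⟦ R ⟧ imp f U A B)
    impP  : ∀ {Γ₁ Γ₂ R f U A B} → U ∋ R → ⊢ Γ₁ ++ [ ⟦ preimage f R ⟧ A ] → ⊢ Γ₂ ++ [ ⟦ R ⟧ B ]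
          → Introduced (Γ₁ ++ Γ₂) (⟦ R ⟧ imp f U A B)
    andN₁ : ∀ {Γ R U A B} → ¬ (U ∋ R) → ⊢ Γ ++ [ ⟦ R ⟧ A ] → Introduced Γ (⟦ R ⟧ and U A B)
    andN₂ : ∀ {Γ R U A B} → ¬ (U ∋ R) → ⊢ Γ ++ [ ⟦ R ⟧ B ] → Introduced Γ (⟦ R ⟧ and U A B)
    andP  : ∀ {Γ R U A B} → U ∋ R → ⊢ Γ ++ [ ⟦ R ⟧ A ] → ⊢ Γ ++ [ ⟦ R ⟧ B ] → Introduced Γ (⟦ R ⟧ and U A B)
    bangP : ∀ {Γ R U A} → All IsWhyNot Γ → U ∋ R → ⊢ Γ ++ [ ⟦ R ⟧ A ] → Introduced Γ (⟦ R ⟧ bang U A)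
    bangW : ∀ {Γ R U A} → ¬ (U ∋ R) → ⊢ Γ → Introduced Γ (⟦ R ⟧ bang U A)
    bangD : ∀ {Γ R U A} → ¬ (U ∋ R) → ⊢ Γ ++ [ ⟦ R ⟧ A ] → Introduced Γ (⟦ R ⟧ bang U A)
    bangC : ∀ {Γ R U A} → ¬ (U ∋ R) → ⊢ Γ ++ (⟦ R ⟧ bang U A) ∷ (⟦ R ⟧ bang U A) ∷ []
          → Introduced Γ (⟦ R ⟧ bang U A)
    allN  : ∀ {Γ R U A} → ¬ (U ∋ R) → (t : Term j) → ⊢ Γ ++ [ ⟦ R ⟧ inst A t ] → Introduced Γ (⟦ R ⟧ all U A)
    allP  : ∀ {Γ R U A} → U ∋ R → ⊢ wkS Γ ++ [ ⟦ R ⟧ A ] → Introduced Γ (⟦ R ⟧ all U A)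

  -- Replaces the tracked occurrences Θ in a derivation of Γ ++ Θ by copies of E, instantiated by
  -- the substitution σ accumulated under ∀-rules. The cases where a tracked occurrence belongs to an
  -- axiom or is principal are the parameters of the inner module; all other rules commute.
  module Replacement {k} (E : Sequent k)
    (Tracked : ∀ {j} → (Fin k → Term j) → Sequent j → Set₁)
    (Tracked-↭ : ∀ {j} {σ : Fin k → Term j} {Θ Θ'} → Θ ↭ Θ' → Tracked σ Θ → Tracked σ Θ')
    (Tracked-++ : ∀ {j} {σ : Fin k → Term j} Θa Θb → Tracked σ (Θa ++ Θb) → Tracked σ Θa × Tracked σ Θb)
    (Tracked-wk : ∀ {j} {σ : Fin k → Term j} {Θ} → Tracked σ Θ → Tracked (wkσ σ) (wkS Θ))
    (Tracked-WhyNot : ∀ {j} {σ : Fin k → Term j} {x Θ} → Tracked σ (x ∷ Θ) → IsWhyNot x → All IsWhyNot (subS σ E))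
    where

    Replaced : ∀ {j} → (Fin k → Term j) → Sequent j → Sequent j
    Replaced σ Θ = copies (subS σ E) (length Θ)

    Replaceable : ∀ {j} → (Fin k → Term j) → Sequent j → Set₁
    Replaceable σ Δ = ∀ Γ Θ → Δ ↭ Γ ++ Θ → Tracked σ Θ → ⊢ Γ ++ Replaced σ Θ

    data Introducedᴿ {j} (σ : Fin k → Term j) : Sequent j → IFormula j → Set₁ where
      negR  : ∀ {Γ R f A} → ⊢ Γ ++ [ ⟦ preimage f R ⟧ A ] → Replaceable σ (Γ ++ [ ⟦ preimage f R ⟧ A ])
            → Introducedᴿ σ Γ (⟦ R ⟧ neg f A)
      impN  : ∀ {Γ R f U A B} → ¬ (U ∋ R) → ⊢ Γ ++ (⟦ preimage f R ⟧ A) ∷ (⟦ R ⟧ B) ∷ []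
            → Replaceable σ (Γ ++ (⟦ preimage f R ⟧ A) ∷ (⟦ R ⟧ B) ∷ []) → Introducedᴿ σ Γ (⟦ R ⟧ imp f U A B)
      impP  : ∀ {Γ₁ Γ₂ R f U A B} → U ∋ R → ⊢ Γ₁ ++ [ ⟦ preimage f R ⟧ A ] → ⊢ Γ₂ ++ [ ⟦ R ⟧ B ]
            → Introducedᴿ σ (Γ₁ ++ Γ₂) (⟦ R ⟧ imp f U A B)
      andN₁ : ∀ {Γ R U A B} → ¬ (U ∋ R) → ⊢ Γ ++ [ ⟦ R ⟧ A ] → Replaceable σ (Γ ++ [ ⟦ R ⟧ A ])
            → Introducedᴿ σ Γ (⟦ R ⟧ and U A B)
      andN₂ : ∀ {Γ R U A B} → ¬ (U ∋ R) → ⊢ Γ ++ [ ⟦ R ⟧ B ] → Replaceable σ (Γ ++ [ ⟦ R ⟧ B ])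
            → Introducedᴿ σ Γ (⟦ R ⟧ and U A B)
      andP  : ∀ {Γ R U A B} → U ∋ R → ⊢ Γ ++ [ ⟦ R ⟧ A ] → ⊢ Γ ++ [ ⟦ R ⟧ B ] → Introducedᴿ σ Γ (⟦ R ⟧ and U A B)
      bangP : ∀ {Γ R U A} → All IsWhyNot Γ → U ∋ R → ⊢ Γ ++ [ ⟦ R ⟧ A ] → Introducedᴿ σ Γ (⟦ R ⟧ bang U A)
      bangW : ∀ {Γ R U A} → ¬ (U ∋ R) → ⊢ Γ → Replaceable σ Γ → Introducedᴿ σ Γ (⟦ R ⟧ bang U A)
      bangD : ∀ {Γ R U A} → ¬ (U ∋ R) → ⊢ Γ ++ [ ⟦ R ⟧ A ] → Replaceable σ (Γ ++ [ ⟦ R ⟧ A ])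
            → Introducedᴿ σ Γ (⟦ R ⟧ bang U A)
      bangC : ∀ {Γ R U A} → ¬ (U ∋ R) → ⊢ Γ ++ (⟦ R ⟧ bang U A) ∷ (⟦ R ⟧ bang U A) ∷ []
            → Replaceable σ (Γ ++ (⟦ R ⟧ bang U A) ∷ (⟦ R ⟧ bang U A) ∷ []) → Introducedᴿ σ Γ (⟦ R ⟧ bang U A)
      allN  : ∀ {Γ R U A} → ¬ (U ∋ R) → (t : Term j) → ⊢ Γ ++ [ ⟦ R ⟧ inst A t ]
            → Replaceable σ (Γ ++ [ ⟦ R ⟧ inst A t ]) → Introducedᴿ σ Γ (⟦ R ⟧ all U A)
      allP  : ∀ {Γ R U A} → U ∋ R → ⊢ wkS Γ ++ [ ⟦ R ⟧ A ] → Introducedᴿ σ Γ (⟦ R ⟧ all U A)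

    forget : ∀ {j} {σ : Fin k → Term j} {Γ x} → Introducedᴿ σ Γ x → Introduced Γ x
    forget (negR d _) = negR d
    forget (impN R∉U d _) = impN R∉U d
    forget (impP R∈U d e) = impP R∈U d e
    forget (andN₁ R∉U d _) = andN₁ R∉U d
    forget (andN₂ R∉U d _) = andN₂ R∉U d
    forget (andP R∈U d e) = andP R∈U d e
    forget (bangP ws R∈U d) = bangP ws R∈U d
    forget (bangW R∉U d _) = bangW R∉U d
    forget (bangD R∉U d _) = bangD R∉U d
    forget (bangC R∉U d _) = bangC R∉U d
    forget (allN R∉U t d _) = allN R∉U t d
    forget (allP R∈U d) = allP R∈U d

    Replaced-↭ : ∀ {j} (σ : Fin k → Term j) {Θ Θ'} → Θ ↭ Θ' → Replaced σ Θ ≡ Replaced σ Θ'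
    Replaced-↭ σ q = cong (copies (subS σ E)) (↭.↭-length q)

    Replaced-++ : ∀ {j} (σ : Fin k → Term j) Θa Θb → Replaced σ (Θa ++ Θb) ≡ Replaced σ Θa ++ Replaced σ Θb
    Replaced-++ σ Θa Θb = trans (cong (copies (subS σ E)) (length-++ Θa)) (copies-+ (subS σ E) (length Θa) (length Θb))

    Replaced-wk : ∀ {j} (σ : Fin k → Term j) Θ → Replaced (wkσ σ) (wkS Θ) ≡ wkS (Replaced σ Θ)
    Replaced-wk σ Θ = begin
      copies (subS (wkσ σ) E) (length (wkS Θ))  ≡⟨ cong (copies (subS (wkσ σ) E)) (length-map wkI Θ) ⟩
      copies (subS (wkσ σ) E) (length Θ)        ≡⟨ cong (λ E' → copies E' (length Θ)) (wkS-subS σ E) ⟨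
      copies (wkS (subS σ E)) (length Θ)        ≡⟨ map-copies wkI (subS σ E) (length Θ) ⟨
      wkS (Replaced σ Θ)                        ∎
      where open ≡-Reasoning

    Replaced-WhyNot : ∀ {j} (σ : Fin k → Term j) Θ → Tracked σ Θ → All IsWhyNot Θ → All IsWhyNot (Replaced σ Θ)
    Replaced-WhyNot σ [] _ _ = []
    Replaced-WhyNot σ (x ∷ Θ) tr (w ∷ _) = copies⁺ (Tracked-WhyNot tr w) (length (x ∷ Θ))

    module _
      (axiom : ∀ {j} (σ : Fin k → Term j) {n} a (Rs : Fin (suc n) → Subset) → IsPartition Rs → ∀ Γ Θ
             → tabulateL (λ i → ⟦ Rs i ⟧ atom a) ↭ Γ ++ Θ → Tracked σ Θ → ⊢ Γ ++ Replaced σ Θ)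
      (principal : ∀ {j} (σ : Fin k → Term j) Γ Γ₀ x Θ → Tracked σ (x ∷ Θ) → Γ₀ ↭ Γ ++ Θ
                 → Introducedᴿ σ Γ₀ x → ⊢ Γ ++ Replaced σ (x ∷ Θ))
      where

      replace-principal : ∀ {j} (σ : Fin k → Term j) {Γ Γ₀ Θ Θ' x} → Θ ↭ x ∷ Θ' → Γ₀ ↭ Γ ++ Θ' → Tracked σ Θ
                        → Introducedᴿ σ Γ₀ x → ⊢ Γ ++ Replaced σ Θ
      replace-principal σ {Γ} {Γ₀} {Θ} {Θ'} {x} qΘ q₀ tr I =
        subst (λ Δ → ⊢ Γ ++ Δ) (sym (Replaced-↭ σ qΘ)) (principal σ Γ Γ₀ x Θ' (Tracked-↭ qΘ tr) q₀ I)

      -- x is not tracked: replace in the premise, then apply the same rule.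
      replace-passive : ∀ {j} (σ : Fin k → Term j) {Γ Γ' Γ₀ Θ x} (Y : Sequent j) → Γ ↭ x ∷ Γ' → Γ₀ ↭ Γ' ++ Θ
                      → Tracked σ Θ → Replaceable σ (Γ₀ ++ Y)
                      → (⊢ (Γ' ++ Replaced σ Θ) ++ Y → ⊢ (Γ' ++ Replaced σ Θ) ++ [ x ])
                      → ⊢ Γ ++ Replaced σ Θ
      replace-passive σ {Γ} {Γ'} {Γ₀} {Θ} {x} Y qΓ q₀ tr ih rule =
        exch (∷ʳ↭∷ x _ ⟫ ↭.++⁺ʳ (Replaced σ Θ) (↭-sym qΓ))
          (rule (exch (++-swapʳ Γ' Y (Replaced σ Θ)) (ih (Γ' ++ Y) Θ (↭.++⁺ʳ Y q₀ ⟫ ++-swapʳ Γ' Θ Y) tr)))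

      replace-passive₂ : ∀ {j} (σ : Fin k → Term j) {Γ Γ' Γ₀ Θ x} (Y Z : Sequent j) → Γ ↭ x ∷ Γ' → Γ₀ ↭ Γ' ++ Θ
                       → Tracked σ Θ → Replaceable σ (Γ₀ ++ Y) → Replaceable σ (Γ₀ ++ Z)
                       → (⊢ (Γ' ++ Replaced σ Θ) ++ Y → ⊢ (Γ' ++ Replaced σ Θ) ++ Z → ⊢ (Γ' ++ Replaced σ Θ) ++ [ x ])
                       → ⊢ Γ ++ Replaced σ Θ
      replace-passive₂ σ {Γ} {Γ'} {Γ₀} {Θ} {x} Y Z qΓ q₀ tr ih ih' rule =
        replace-passive σ Y qΓ q₀ tr ih λ d →
          rule d (exch (++-swapʳ Γ' Z (Replaced σ Θ)) (ih' (Γ' ++ Z) Θ (↭.++⁺ʳ Z q₀ ⟫ ++-swapʳ Γ' Θ Z) tr))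

      replace-impP : ∀ {j} (σ : Fin k → Term j) {Γ Γ' Γ₁ Γ₂ Θ R f U A B} → U ∋ R
                   → ⊢ Γ₁ ++ [ ⟦ preimage f R ⟧ A ] → ⊢ Γ₂ ++ [ ⟦ R ⟧ B ]
                   → Γ ↭ ⟦ R ⟧ imp f U A B ∷ Γ' → Γ₁ ++ Γ₂ ↭ Γ' ++ Θ → Tracked σ Θ → ⊢ Γ ++ Replaced σ Θ

      replace-allP : ∀ {j} (σ : Fin k → Term j) {Γ Γ' Γ₀ Θ R U A} → U ∋ R → ⊢ wkS Γ₀ ++ [ ⟦ R ⟧ A ]
                   → Γ ↭ ⟦ R ⟧ all U A ∷ Γ' → Γ₀ ↭ Γ' ++ Θ → Tracked σ Θ → ⊢ Γ ++ Replaced σ Θ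

      replace : ∀ {j} (σ : Fin k → Term j) {Δ} → ⊢ Δ → Replaceable σ Δ
      replace σ (exch p d) Γ Θ q tr = replace σ d Γ Θ (p ⟫ q) tr
      replace σ (Id a Rs part) Γ Θ q tr = axiom σ a Rs part Γ Θ q tr
      replace σ (negR d) Γ Θ q tr with split-∷ʳ q
      ... | inj₁ (_ , qΘ , q₀) = replace-principal σ qΘ q₀ tr (negR d (replace σ d))
      ... | inj₂ (_ , qΓ , q₀) = replace-passive σ _ qΓ q₀ tr (replace σ d) negR
      replace σ (impN R∉U d) Γ Θ q tr with split-∷ʳ q
      ... | inj₁ (_ , qΘ , q₀) = replace-principal σ qΘ q₀ tr (impN R∉U d (replace σ d))
      ... | inj₂ (_ , qΓ , q₀) = replace-passive σ _ qΓ q₀ tr (replace σ d) (impN R∉U)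
      replace σ (impP {Γ₁} {Γ₂} R∈U d e) Γ Θ q tr with split-∷ʳ {Δ = Γ₁ ++ Γ₂} q
      ... | inj₁ (_ , qΘ , q₀) = replace-principal σ qΘ q₀ tr (impP R∈U d e)
      ... | inj₂ (Γ' , qΓ , q₀) = replace-impP σ R∈U d e qΓ q₀ tr
      replace σ (andN₁ R∉U d) Γ Θ q tr with split-∷ʳ q
      ... | inj₁ (_ , qΘ , q₀) = replace-principal σ qΘ q₀ tr (andN₁ R∉U d (replace σ d))
      ... | inj₂ (_ , qΓ , q₀) = replace-passive σ _ qΓ q₀ tr (replace σ d) (andN₁ R∉U)
      replace σ (andN₂ R∉U d) Γ Θ q tr with split-∷ʳ q
      ... | inj₁ (_ , qΘ , q₀) = replace-principal σ qΘ q₀ tr (andN₂ R∉U d (replace σ d))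
      ... | inj₂ (_ , qΓ , q₀) = replace-passive σ _ qΓ q₀ tr (replace σ d) (andN₂ R∉U)
      replace σ (andP R∈U d e) Γ Θ q tr with split-∷ʳ q
      ... | inj₁ (_ , qΘ , q₀) = replace-principal σ qΘ q₀ tr (andP R∈U d e)
      ... | inj₂ (_ , qΓ , q₀) = replace-passive₂ σ _ _ qΓ q₀ tr (replace σ d) (replace σ e) (andP R∈U)
      replace σ (bangP ws R∈U d) Γ Θ q tr with split-∷ʳ q
      ... | inj₁ (_ , qΘ , q₀) = replace-principal σ qΘ q₀ tr (bangP ws R∈U d)
      ... | inj₂ (Γ' , qΓ , q₀) = replace-passive σ _ qΓ q₀ tr (replace σ d) (bangP ws' R∈U)
        where
          ws₀ = ↭.All-resp-↭ q₀ ws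
          ws' = Allₚ.++⁺ (Allₚ.++⁻ˡ Γ' ws₀) (Replaced-WhyNot σ Θ tr (Allₚ.++⁻ʳ Γ' ws₀))
      replace σ (bangW R∉U d) Γ Θ q tr with split-∷ʳ q
      ... | inj₁ (_ , qΘ , q₀) = replace-principal σ qΘ q₀ tr (bangW R∉U d (replace σ d))
      ... | inj₂ (Γ' , qΓ , q₀) = exch (∷ʳ↭∷ _ _ ⟫ ↭.++⁺ʳ (Replaced σ Θ) (↭-sym qΓ)) (bangW R∉U (replace σ d Γ' Θ q₀ tr))
      replace σ (bangD R∉U d) Γ Θ q tr with split-∷ʳ q
      ... | inj₁ (_ , qΘ , q₀) = replace-principal σ qΘ q₀ tr (bangD R∉U d (replace σ d))
      ... | inj₂ (_ , qΓ , q₀) = replace-passive σ _ qΓ q₀ tr (replace σ d) (bangD R∉U)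
      replace σ (bangC R∉U d) Γ Θ q tr with split-∷ʳ q
      ... | inj₁ (_ , qΘ , q₀) = replace-principal σ qΘ q₀ tr (bangC R∉U d (replace σ d))
      ... | inj₂ (_ , qΓ , q₀) = replace-passive σ _ qΓ q₀ tr (replace σ d) (bangC R∉U)
      replace σ (allN R∉U t d) Γ Θ q tr with split-∷ʳ q
      ... | inj₁ (_ , qΘ , q₀) = replace-principal σ qΘ q₀ tr (allN R∉U t d (replace σ d))
      ... | inj₂ (_ , qΓ , q₀) = replace-passive σ _ qΓ q₀ tr (replace σ d) (allN R∉U t)
      replace σ (allP R∈U d) Γ Θ q tr with split-∷ʳ q
      ... | inj₁ (_ , qΘ , q₀) = replace-principal σ qΘ q₀ tr (allP R∈U d)
      ... | inj₂ (Γ' , qΓ , q₀) = replace-allP σ R∈U d qΓ q₀ tr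


      replace-impP σ {Γ} {Γ'} {Γ₁} {Γ₂} {Θ} {R} {f} {U} {A} {B} R∈U d e qΓ q₀ tr
        with Θa , Θb , Γa , Γb , r₁ , r₂ , r₃ , r₄ ← split-++ Γ₁ Γ₂ Γ' Θ q₀
        with tra , trb ← Tracked-++ Θa Θb (Tracked-↭ r₁ tr) =
        exch reorder (impP R∈U (replace-one d Γa Θa r₂ tra) (replace-one e Γb Θb r₃ trb))
        where
          replace-one : ∀ {Δ y} → ⊢ Δ ++ [ y ] → ∀ Γ'' Θ'' → Δ ↭ Γ'' ++ Θ'' → Tracked σ Θ''
                      → ⊢ (Γ'' ++ Replaced σ Θ'') ++ [ y ]
          replace-one {y = y} d' Γ'' Θ'' q' tr' =
            exch (++-swapʳ Γ'' [ y ] (Replaced σ Θ'')) (replace σ d' (Γ'' ++ [ y ]) Θ'' (↭.++⁺ʳ [ y ] q' ⟫ ++-swapʳ Γ'' Θ'' [ y ]) tr')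
          RΘa = Replaced σ Θa
          RΘb = Replaced σ Θb
          reorder : ((Γa ++ RΘa) ++ (Γb ++ RΘb)) ++ [ ⟦ R ⟧ imp f U A B ] ↭ Γ ++ Replaced σ Θ
          reorder =
            prove 5 (((v₀ ⊕ v₁) ⊕ (v₂ ⊕ v₃)) ⊕ v₄) ((v₄ ⊕ (v₀ ⊕ v₂)) ⊕ (v₁ ⊕ v₃)) (Γa ∷ RΘa ∷ Γb ∷ RΘb ∷ [ ⟦ R ⟧ imp f U A B ] ∷ [])
            ⟫ ↭.++⁺ (↭-sym (↭-prep _ r₄) ⟫ ↭-sym qΓ) (↭-reflexive (sym (trans (Replaced-↭ σ r₁) (Replaced-++ σ Θa Θb))))


      replace-allP σ {Γ} {Γ'} {Γ₀} {Θ} {R} {U} {A} R∈U d qΓ q₀ tr =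
        exch (∷ʳ↭∷ _ _ ⟫ ↭.++⁺ʳ (Replaced σ Θ) (↭-sym qΓ)) (allP R∈U (subst (λ Δ → ⊢ Δ ++ [ ⟦ R ⟧ A ]) eq
          (exch (++-swapʳ (wkS Γ') [ ⟦ R ⟧ A ] _)
            (replace (wkσ σ) d (wkS Γ' ++ [ ⟦ R ⟧ A ]) (wkS Θ) q' (Tracked-wk tr)))))
        where
          q' : wkS Γ₀ ++ [ ⟦ R ⟧ A ] ↭ (wkS Γ' ++ [ ⟦ R ⟧ A ]) ++ wkS Θ
          q' = ↭.++⁺ʳ _ (↭.map⁺ wkI q₀ ⟫ ↭-reflexive (map-++ wkI Γ' Θ)) ⟫ ++-swapʳ (wkS Γ') (wkS Θ) _
          eq : wkS Γ' ++ Replaced (wkσ σ) (wkS Θ) ≡ wkS (Γ' ++ Replaced σ Θ)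
          eq = trans (cong (wkS Γ' ++_) (Replaced-wk σ Θ)) (sym (map-++ wkI Γ' (Replaced σ Θ)))

  -- Partitions and identity axioms

  Disjoint : Subset → Subset → Set
  Disjoint P Q = ∀ r → P r → Q r → ⊥

  Disjoint-sym : ∀ {P Q} → Disjoint P Q → Disjoint Q P
  Disjoint-sym d r q p = d r p q

  Covers : List Subset → Set₁
  Covers Qs = ∀ r → Any (λ Q → Q r) Qs

  IsListPartition : List Subset → Set₁
  IsListPartition Qs = AllPairs Disjoint Qs × Covers Qs

  AllPairs-Disjoint-↭ : ∀ {Ps Qs} → Ps ↭ Qs → AllPairs Disjoint Ps → AllPairs Disjoint Qs
  AllPairs-Disjoint-↭ Perm.refl a = a
  AllPairs-Disjoint-↭ (Perm.prep _ p) (h ∷ a) = ↭.All-resp-↭ p h ∷ AllPairs-Disjoint-↭ p a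
  AllPairs-Disjoint-↭ (Perm.swap _ _ p) ((dxy ∷ hx) ∷ hy ∷ a) =
    (Disjoint-sym dxy ∷ ↭.All-resp-↭ p hy) ∷ ↭.All-resp-↭ p hx ∷ AllPairs-Disjoint-↭ p a
  AllPairs-Disjoint-↭ (Perm.trans p q) a = AllPairs-Disjoint-↭ q (AllPairs-Disjoint-↭ p a)

  IsListPartition-↭ : ∀ {Ps Qs} → Ps ↭ Qs → IsListPartition Ps → IsListPartition Qs
  IsListPartition-↭ p (a , c) = AllPairs-Disjoint-↭ p a , λ r → ↭.Any-resp-↭ p (c r)

  IsPartition⇒IsListPartition : ∀ {n} (Rs : Fin n → Subset) → IsPartition Rs → IsListPartition (tabulate Rs)
  IsPartition⇒IsListPartition Rs (disj , cover) =
    AllPairs.tabulate⁺ (λ {i} {j} i≢j → disj i j i≢j) , λ r → Anyₚ.tabulate⁺ (proj₁ (cover r)) (proj₂ (cover r))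

  lookup-Disjoint : ∀ {Qs} → AllPairs Disjoint Qs → ∀ i j → i ≢ j → Disjoint (lookup Qs i) (lookup Qs j)
  lookup-Disjoint (_ ∷ _) zero zero i≢j = ⊥-elim (i≢j refl)
  lookup-Disjoint (h ∷ _) zero (suc j) _ = All.lookup h (∈-lookup j)
  lookup-Disjoint (h ∷ _) (suc i) zero _ = Disjoint-sym (All.lookup h (∈-lookup i))
  lookup-Disjoint (_ ∷ a) (suc i) (suc j) i≢j = lookup-Disjoint a i j (i≢j ∘ cong suc)

  IsListPartition⇒IsPartition : ∀ {Qs} → IsListPartition Qs → IsPartition (lookup Qs)
  IsListPartition⇒IsPartition (disj , cover) =
    lookup-Disjoint disj , λ r → index (cover r) , Anyₚ.lookup-index (cover r)

  atomI : ∀ {k} → Atom k → Subset → IFormula k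
  atomI a R = ⟦ R ⟧ atom a

  ⊢-Id-list : ∀ {k} (a : Atom k) {Q Qs} → IsListPartition (Q ∷ Qs) → ⊢ map (atomI a) (Q ∷ Qs)
  ⊢-Id-list a {Q} {Qs} P = subst ⊢_ eq (Id a (lookup (Q ∷ Qs)) (IsListPartition⇒IsPartition P))
    where
      open ≡-Reasoning
      eq : tabulateL (atomI a ∘ lookup (Q ∷ Qs)) ≡ map (atomI a) (Q ∷ Qs)
      eq = begin
        tabulateL (atomI a ∘ lookup (Q ∷ Qs))    ≡⟨ tabulateL≡tabulate (atomI a ∘ lookup (Q ∷ Qs)) ⟩
        tabulate (atomI a ∘ lookup (Q ∷ Qs))     ≡⟨ map-tabulate (lookup (Q ∷ Qs)) (atomI a) ⟨
        map (atomI a) (tabulate (lookup (Q ∷ Qs))) ≡⟨ cong (map (atomI a)) (tabulate-lookup (Q ∷ Qs)) ⟩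
        map (atomI a) (Q ∷ Qs)                   ∎

  tabulateL-atomI : ∀ {k n} (a : Atom k) (Rs : Fin n → Subset)
                  → tabulateL (λ i → ⟦ Rs i ⟧ atom a) ≡ map (atomI a) (tabulate Rs)
  tabulateL-atomI a Rs = trans (tabulateL≡tabulate (atomI a ∘ Rs)) (sym (map-tabulate Rs (atomI a)))

  Id-split : ∀ {k n} (a : Atom k) (Rs : Fin (suc n) → Subset) → IsPartition Rs → ∀ Γ Θ
           → tabulateL (λ i → ⟦ Rs i ⟧ atom a) ↭ Γ ++ Θ
           → ∃ λ Qa → ∃ λ Qb → IsListPartition (Qa ++ Qb) × Γ ≡ map (atomI a) Qa × Θ ≡ map (atomI a) Qb
  Id-split a Rs part Γ Θ q
    with Qs , e , p ← ↭.↭-map-inv (atomI a) (subst (_↭ Γ ++ Θ) (tabulateL-atomI a Rs) q)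
    with Qa , Qb , refl , eΓ , eΘ ← map-≡-++⁻ (atomI a) Qs Γ Θ (sym e) =
    Qa , Qb , IsListPartition-↭ p (IsPartition⇒IsListPartition Rs part) , eΓ , eΘ

  -- Erasing i-formulas that hold for no role

  ∉-Empty : ∀ (U : Ultrafilter) {R} → Empty R → ¬ (U ∋ R)
  ∉-Empty U e R∈U = proper U (up U (λ {r} → e r) R∈U)

  roles : ∀ {k} → IFormula k → Subset
  roles (⟦ R ⟧ _) = R

  Vacuous : ∀ {k} → Sequent k → Set₁
  Vacuous = All (Empty ∘ roles)

  Vacuous-wkS : ∀ {k} {Θ : Sequent k} → Vacuous Θ → Vacuous (wkS Θ)
  Vacuous-wkS [] = []
  Vacuous-wkS {Θ = (⟦ R ⟧ A) ∷ Θ} (e ∷ es) = e ∷ Vacuous-wkS es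

  -- The role r₀ is needed: over an empty set of roles ⊢ [ ∅ ] a is an axiom, but the empty
  -- sequent is not derivable.
  module Erasure (r₀ : Role) {k : ℕ} where
    open Replacement {k} [] (λ _ → Vacuous) (λ p → ↭.All-resp-↭ p) (λ Θa _ → Allₚ.++⁻ Θa) Vacuous-wkS (λ _ _ → [])

    Replaced≡[] : ∀ {j} (σ : Fin k → Term j) Θ → Replaced σ Θ ≡ []
    Replaced≡[] σ Θ = copies-[] (length Θ)

    drop : ∀ {j} (σ : Fin k → Term j) {Γ} Θ → ⊢ Γ ++ Replaced σ Θ → ⊢ Γ
    drop σ {Γ} Θ = subst ⊢_ (trans (cong (Γ ++_) (Replaced≡[] σ Θ)) (++-identityʳ Γ))

    pad : ∀ {j} (σ : Fin k → Term j) {Γ} Θ → ⊢ Γ → ⊢ Γ ++ Replaced σ Θ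
    pad σ {Γ} Θ = subst ⊢_ (sym (trans (cong (Γ ++_) (Replaced≡[] σ Θ)) (++-identityʳ Γ)))

    ⊢-Id-covering : ∀ {j} (a : Atom j) Qs → IsListPartition Qs → ⊢ map (atomI a) Qs
    ⊢-Id-covering a [] (_ , cover) with () ← cover r₀
    ⊢-Id-covering a (Q ∷ Qs) P = ⊢-Id-list a P

    erase-axiom : ∀ {j} (σ : Fin k → Term j) {n} a (Rs : Fin (suc n) → Subset) → IsPartition Rs → ∀ Γ Θ
                → tabulateL (λ i → ⟦ Rs i ⟧ atom a) ↭ Γ ++ Θ → Vacuous Θ → ⊢ Γ ++ Replaced σ Θ
    erase-axiom σ a Rs part Γ Θ q vΘ
      with Qa , Qb , (disj , cover) , refl , refl ← Id-split a Rs part Γ Θ q =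
      pad σ (map (atomI a) Qb) (⊢-Id-covering a Qa (proj₁ (AllPairs-++⁻ Qa disj) , cover-Qa))
      where
        cover-Qa : Covers Qa
        cover-Qa r with Anyₚ.++⁻ Qa (cover r)
        ... | inj₁ r∈Qa = r∈Qa
        ... | inj₂ r∈Qb = ⊥-elim (Allₚ.All¬⇒¬Any (All.map (λ e → e r) (Allₚ.map⁻ vΘ)) r∈Qb)

    erase-premise : ∀ {j} (σ : Fin k → Term j) {Γ Γ₀ Θ} Y → Γ₀ ↭ Γ ++ Θ → Vacuous Θ → Vacuous Y
                  → Replaceable σ (Γ₀ ++ Y) → ⊢ Γ
    erase-premise σ {Γ} {Θ = Θ} Y q₀ vΘ vY ih =
      drop σ (Θ ++ Y) (ih Γ (Θ ++ Y) (↭.++⁺ʳ Y q₀ ⟫ ↭-reflexive (++-assoc Γ Θ Y)) (Allₚ.++⁺ vΘ vY))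

    erase-principal : ∀ {j} (σ : Fin k → Term j) Γ Γ₀ x Θ → Vacuous (x ∷ Θ) → Γ₀ ↭ Γ ++ Θ
                    → Introducedᴿ σ Γ₀ x → ⊢ Γ ++ Replaced σ (x ∷ Θ)
    erase-principal σ Γ Γ₀ x Θ (e ∷ vΘ) q₀ (negR {R = R} {f} {A} _ ih) =
      pad σ (x ∷ Θ) (erase-premise σ [ ⟦ preimage f R ⟧ A ] q₀ vΘ ((e ∘ f) ∷ []) ih)
    erase-principal σ Γ Γ₀ x Θ (e ∷ vΘ) q₀ (impN {R = R} {f} {A = A} {B} _ _ ih) =
      pad σ (x ∷ Θ) (erase-premise σ (⟦ preimage f R ⟧ A ∷ ⟦ R ⟧ B ∷ []) q₀ vΘ ((e ∘ f) ∷ e ∷ []) ih)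
    erase-principal σ Γ Γ₀ x Θ (e ∷ vΘ) q₀ (impP {U = U} R∈U _ _) = ⊥-elim (∉-Empty U e R∈U)
    erase-principal σ Γ Γ₀ x Θ (e ∷ vΘ) q₀ (andN₁ {R = R} {A = A} _ _ ih) =
      pad σ (x ∷ Θ) (erase-premise σ [ ⟦ R ⟧ A ] q₀ vΘ (e ∷ []) ih)
    erase-principal σ Γ Γ₀ x Θ (e ∷ vΘ) q₀ (andN₂ {R = R} {B = B} _ _ ih) =
      pad σ (x ∷ Θ) (erase-premise σ [ ⟦ R ⟧ B ] q₀ vΘ (e ∷ []) ih)
    erase-principal σ Γ Γ₀ x Θ (e ∷ vΘ) q₀ (andP {U = U} R∈U _ _) = ⊥-elim (∉-Empty U e R∈U)
    erase-principal σ Γ Γ₀ x Θ (e ∷ vΘ) q₀ (bangP {U = U} _ R∈U _) = ⊥-elim (∉-Empty U e R∈U)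
    erase-principal σ Γ Γ₀ x Θ (e ∷ vΘ) q₀ (bangW _ _ ih) = pad σ (x ∷ Θ) (drop σ Θ (ih Γ Θ q₀ vΘ))
    erase-principal σ Γ Γ₀ x Θ (e ∷ vΘ) q₀ (bangD {R = R} {A = A} _ _ ih) =
      pad σ (x ∷ Θ) (erase-premise σ [ ⟦ R ⟧ A ] q₀ vΘ (e ∷ []) ih)
    erase-principal σ Γ Γ₀ x Θ (e ∷ vΘ) q₀ (bangC {R = R} {U} {A} _ _ ih) =
      pad σ (x ∷ Θ) (erase-premise σ (⟦ R ⟧ bang U A ∷ ⟦ R ⟧ bang U A ∷ []) q₀ vΘ (e ∷ e ∷ []) ih)
    erase-principal σ Γ Γ₀ x Θ (e ∷ vΘ) q₀ (allN {R = R} {A = A} _ t _ ih) =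
      pad σ (x ∷ Θ) (erase-premise σ [ ⟦ R ⟧ inst A t ] q₀ vΘ (e ∷ []) ih)
    erase-principal σ Γ Γ₀ x Θ (e ∷ vΘ) q₀ (allP {U = U} R∈U _) = ⊥-elim (∉-Empty U e R∈U)

    erase : ∀ {Γ : Sequent k} {R A} → Empty R → ⊢ Γ ++ [ ⟦ R ⟧ A ] → ⊢ Γ
    erase {Γ} {R} {A} e d = drop var [ ⟦ R ⟧ A ] (replace erase-axiom erase-principal var d Γ [ ⟦ R ⟧ A ] ↭-refl (e ∷ []))

  -- Merging two derivations

  ⊢-weaken-WhyNot : ∀ {k} {E : Sequent k} → All IsWhyNot E → ∀ {Δ} → ⊢ Δ → ⊢ Δ ++ E
  ⊢-weaken-WhyNot [] {Δ} d = subst ⊢_ (sym (++-identityʳ Δ)) d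
  ⊢-weaken-WhyNot {E = x ∷ E} (whyNot R∉U ∷ ws) {Δ} d =
    exch (prove 3 ((v₀ ⊕ v₁) ⊕ v₂) (v₀ ⊕ v₂ ⊕ v₁) (Δ ∷ E ∷ [ x ] ∷ [])) (bangW R∉U (⊢-weaken-WhyNot ws d))

  ⊢-contract-WhyNot : ∀ {k} {E : Sequent k} → All IsWhyNot E → ∀ {Δ} → ⊢ Δ ++ E ++ E → ⊢ Δ ++ E
  ⊢-contract-WhyNot [] d = d
  ⊢-contract-WhyNot {E = x ∷ E} (whyNot R∉U ∷ ws) {Δ} d =
    exch (prove 3 ((v₀ ⊕ v₁) ⊕ v₂) (v₀ ⊕ v₁ ⊕ v₂) (Δ ∷ [ x ] ∷ E ∷ []))
      (⊢-contract-WhyNot ws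
        (exch (prove 3 ((v₀ ⊕ v₁ ⊕ v₁) ⊕ v₂) ((v₀ ⊕ v₂) ⊕ v₁ ⊕ v₁) (Δ ∷ E ∷ [ x ] ∷ []))
          (bangC R∉U (exch (prove 3 (v₀ ⊕ (v₂ ⊕ v₁) ⊕ (v₂ ⊕ v₁)) ((v₀ ⊕ v₁ ⊕ v₁) ⊕ v₂ ⊕ v₂) (Δ ∷ E ∷ [ x ] ∷ [])) d))))

  ⊢-sub-∷ʳ : ∀ {k j} (σ : Fin k → Term j) {Γ y} → ⊢ Γ ++ [ y ] → ⊢ subS σ Γ ++ [ subI σ y ]
  ⊢-sub-∷ʳ σ {Γ} = ⊢-subS-++⁻ σ Γ ∘ ⊢-sub σ

  Introduced-sub : ∀ {k j} (σ : Fin k → Term j) {Γ x} → Introduced Γ x → Introduced (subS σ Γ) (subI σ x)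
  Introduced-sub σ (negR d) = negR (⊢-sub-∷ʳ σ d)
  Introduced-sub σ (impN {Γ} R∉U d) = impN R∉U (⊢-subS-++⁻ σ Γ (⊢-sub σ d))
  Introduced-sub σ (impP {Γ₁} {Γ₂} R∈U d e) =
    subst (λ Γ → Introduced Γ _) (sym (subS-++ σ Γ₁ Γ₂)) (impP R∈U (⊢-sub-∷ʳ σ d) (⊢-sub-∷ʳ σ e))
  Introduced-sub σ (andN₁ R∉U d) = andN₁ R∉U (⊢-sub-∷ʳ σ d)
  Introduced-sub σ (andN₂ R∉U d) = andN₂ R∉U (⊢-sub-∷ʳ σ d)
  Introduced-sub σ (andP R∈U d e) = andP R∈U (⊢-sub-∷ʳ σ d) (⊢-sub-∷ʳ σ e)
  Introduced-sub σ (bangP ws R∈U d) = bangP (subS-WhyNot σ ws) R∈U (⊢-sub-∷ʳ σ d)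
  Introduced-sub σ (bangW R∉U d) = bangW R∉U (⊢-sub σ d)
  Introduced-sub σ (bangD R∉U d) = bangD R∉U (⊢-sub-∷ʳ σ d)
  Introduced-sub σ (bangC {Γ} R∉U d) = bangC R∉U (⊢-subS-++⁻ σ Γ (⊢-sub σ d))
  Introduced-sub σ (allN {Γ} {R} {U} {A} R∉U t d) =
    allN R∉U (subT σ t) (subst (λ B → ⊢ subS σ Γ ++ [ ⟦ R ⟧ B ]) (subF-inst σ A t) (⊢-sub-∷ʳ σ d))
  Introduced-sub σ (allP {Γ} {R} {U} {A} R∈U d) =
    allP R∈U (subst (λ Δ → ⊢ Δ ++ [ ⟦ R ⟧ subF (liftS σ) A ]) (subS-liftS-wkS σ Γ) (⊢-sub-∷ʳ (liftS σ) d))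

  module _ {k} (x : IFormula k) (E : Sequent k) (E-WhyNot : IsWhyNot x → All IsWhyNot E) where

    AtMostX : ∀ {j} → (Fin k → Term j) → Sequent j → Set₁
    AtMostX σ Θ = Θ ≡ [] ⊎ Θ ≡ [ subI σ x ]

    private
      AtMostX-↭ : ∀ {j} {σ : Fin k → Term j} {Θ Θ'} → Θ ↭ Θ' → AtMostX σ Θ → AtMostX σ Θ'
      AtMostX-↭ q (inj₁ refl) = inj₁ (↭.↭-empty-inv (↭-sym q))
      AtMostX-↭ q (inj₂ refl) = inj₂ (↭.↭-singleton-inv (↭-sym q))

      AtMostX-++ : ∀ {j} {σ : Fin k → Term j} Θa Θb → AtMostX σ (Θa ++ Θb) → AtMostX σ Θa × AtMostX σ Θb
      AtMostX-++ [] Θb t = inj₁ refl , t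
      AtMostX-++ (y ∷ Θa) Θb (inj₂ e) with refl , e' ← ∷-injective e =
        inj₂ (cong (y ∷_) (++-conicalˡ Θa Θb e')) , inj₁ (++-conicalʳ Θa Θb e')

      AtMostX-wk : ∀ {j} {σ : Fin k → Term j} {Θ} → AtMostX σ Θ → AtMostX (wkσ σ) (wkS Θ)
      AtMostX-wk (inj₁ refl) = inj₁ refl
      AtMostX-wk {σ = σ} (inj₂ refl) = inj₂ (cong [_] (wkI-subI σ x))

      AtMostX-WhyNot : ∀ {j} {σ : Fin k → Term j} {y Θ} → AtMostX σ (y ∷ Θ) → IsWhyNot y → All IsWhyNot (subS σ E)
      AtMostX-WhyNot {σ = σ} (inj₂ refl) w = subS-WhyNot σ (E-WhyNot (WhyNot-subI⁻ σ x w))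

    open Replacement E AtMostX AtMostX-↭ AtMostX-++ AtMostX-wk AtMostX-WhyNot

    replace-single :
      (∀ {j} (σ : Fin k → Term j) {n} a (Rs : Fin (suc n) → Subset) → IsPartition Rs → ∀ Γ
         → tabulateL (λ i → ⟦ Rs i ⟧ atom a) ↭ Γ ++ [ subI σ x ] → ⊢ Γ ++ subS σ E)
      → (∀ {j} (σ : Fin k → Term j) Γ → Introduced Γ (subI σ x) → ⊢ Γ ++ subS σ E)
      → ∀ {Γ} → ⊢ Γ ++ [ x ] → ⊢ Γ ++ E
    replace-single axiom₁ principal₁ {Γ} d =
      subst ⊢_ (cong (Γ ++_) (trans (++-identityʳ _) (subS-var E)))
        (replace axiom principal var d Γ [ x ] ↭-refl (inj₂ (cong [_] (sym (subI-var x)))))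
      where
        E[_]≡ : ∀ {j} (σ : Fin k → Term j) → subS σ E ++ [] ≡ subS σ E
        E[ σ ]≡ = ++-identityʳ (subS σ E)

        axiom : ∀ {j} (σ : Fin k → Term j) {n} a (Rs : Fin (suc n) → Subset) → IsPartition Rs → ∀ Γ Θ
              → tabulateL (λ i → ⟦ Rs i ⟧ atom a) ↭ Γ ++ Θ → AtMostX σ Θ → ⊢ Γ ++ Replaced σ Θ
        axiom σ a Rs part Γ' _ q (inj₁ refl) = exch q (Id a Rs part)
        axiom σ a Rs part Γ' _ q (inj₂ refl) =
          subst (λ Δ → ⊢ Γ' ++ Δ) (sym E[ σ ]≡) (axiom₁ σ a Rs part Γ' q)

        principal : ∀ {j} (σ : Fin k → Term j) Γ Γ₀ y Θ → AtMostX σ (y ∷ Θ) → Γ₀ ↭ Γ ++ Θ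
                  → Introducedᴿ σ Γ₀ y → ⊢ Γ ++ Replaced σ (y ∷ Θ)
        principal σ Γ' Γ₀ _ _ (inj₂ refl) q₀ I =
          subst (λ Δ → ⊢ Γ' ++ Δ) (sym E[ σ ]≡)
            (exch (↭.++⁺ʳ _ (q₀ ⟫ ↭-reflexive (++-identityʳ Γ'))) (principal₁ σ Γ₀ (forget I)))

  ∋-or-∉ : ∀ (U : Ultrafilter) R → U ∋ R ⊎ ¬ (U ∋ R)
  ∋-or-∉ U R with ultra U R
  ... | inj₁ R∈U = inj₁ R∈U
  ... | inj₂ ∁R∈U = inj₂ λ R∈U → proper U (up U (λ (r∈R , r∉R) → r∉R r∈R) (inter U R∈U ∁R∈U))

  not-both-∉ : ∀ (U : Ultrafilter) {R₁ R₂} → Disjoint (∁ R₁) (∁ R₂) → ¬ (U ∋ R₁) → ¬ (U ∋ R₂) → ⊥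
  not-both-∉ U {R₁} {R₂} dc R₁∉U R₂∉U with ultra U R₁ | ultra U R₂
  ... | inj₁ R₁∈U | _ = R₁∉U R₁∈U
  ... | inj₂ _ | inj₁ R₂∈U = R₂∉U R₂∈U
  ... | inj₂ ∁R₁∈U | inj₂ ∁R₂∈U = proper U (up U (λ {r} (p , q) → dc r p q) (inter U ∁R₁∈U ∁R₂∈U))

  module _ {L R₁ R₂ : Subset} (L≐ : L ≐ R₁ ∩ R₂) where

    ∋-≐∩ : ∀ (U : Ultrafilter) → U ∋ R₁ → U ∋ R₂ → U ∋ L
    ∋-≐∩ U R₁∈U R₂∈U = up U (proj₂ L≐) (inter U R₁∈U R₂∈U)

    ∉-≐∩ˡ : ∀ (U : Ultrafilter) → ¬ (U ∋ R₁) → ¬ (U ∋ L)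
    ∉-≐∩ˡ U R₁∉U L∈U = R₁∉U (up U (proj₁ ∘ proj₁ L≐) L∈U)

    ∉-≐∩ʳ : ∀ (U : Ultrafilter) → ¬ (U ∋ R₂) → ¬ (U ∋ L)
    ∉-≐∩ʳ U R₂∉U L∈U = R₂∉U (up U (proj₂ ∘ proj₁ L≐) L∈U)

    ≐∩-preimage : ∀ f → preimage f L ≐ preimage f R₁ ∩ preimage f R₂
    ≐∩-preimage f = proj₁ L≐ , proj₂ L≐

    ≐∩-comm : L ≐ R₂ ∩ R₁
    ≐∩-comm = (λ r∈L → swap (proj₁ L≐ r∈L)) , (λ r∈R₂∩R₁ → proj₂ L≐ (swap r∈R₂∩R₁))

    -- The atoms of two axioms, glued along R₁ and R₂, form an axiom with L in their place.
    IsListPartition-≐∩ : ∀ Qs₁ Qs₂ → IsListPartition (Qs₁ ++ [ R₁ ]) → IsListPartition (Qs₂ ++ [ R₂ ])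
                       → Disjoint (∁ R₁) (∁ R₂) → IsListPartition (L ∷ Qs₂ ++ Qs₁)
    IsListPartition-≐∩ Qs₁ Qs₂ (disj₁ , cover₁) (disj₂ , cover₂) dc
      with a₁ , _ , d₁ ← AllPairs-++⁻ Qs₁ disj₁
      with a₂ , _ , d₂ ← AllPairs-++⁻ Qs₂ disj₂ =
      Allₚ.++⁺ (All.map (λ { (d ∷ []) r r∈L q → d r q (proj₂ (proj₁ L≐ r∈L)) }) d₂)
               (All.map (λ { (d ∷ []) r r∈L q → d r q (proj₁ (proj₁ L≐ r∈L)) }) d₁)
      ∷ AllPairs.++⁺ a₂ a₁
          (All.map (λ { (d₂q ∷ []) → All.map (λ { (d₁q ∷ []) r q₂ q₁ → dc r (d₁q r q₁) (d₂q r q₂) }) d₁ }) d₂)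
      , cover
      where
        cover : Covers (L ∷ Qs₂ ++ Qs₁)
        cover r with Anyₚ.++⁻ Qs₁ (cover₁ r)
        ... | inj₁ r∈Qs₁ = there (Anyₚ.++⁺ʳ Qs₂ r∈Qs₁)
        ... | inj₂ (here r∈R₁) with Anyₚ.++⁻ Qs₂ (cover₂ r)
        ...   | inj₁ r∈Qs₂ = there (Anyₚ.++⁺ˡ r∈Qs₂)
        ...   | inj₂ (here r∈R₂) = here (proj₂ L≐ (r∈R₁ , r∈R₂))

  axiom-atomic : ∀ {j n} (a : Atom j) (Rs : Fin (suc n) → Subset) → IsPartition Rs → ∀ Γ {R A}
               → tabulateL (λ i → ⟦ Rs i ⟧ atom a) ↭ Γ ++ [ ⟦ R ⟧ A ] → A ≡ atom a
  axiom-atomic a Rs part Γ q with Id-split a Rs part Γ _ q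
  ... | _ , _ ∷ [] , _ , _ , refl = refl

  subS-atoms : ∀ {k j m} (σ : Fin k → Term j) (p : Rl m) ts Qs
             → subS σ (map (atomI (rel p ts)) Qs) ≡ map (atomI (rel p (subTs σ ts))) Qs
  subS-atoms σ p ts [] = refl
  subS-atoms σ p ts (Q ∷ Qs) = cong (_ ∷_) (subS-atoms σ p ts Qs)

  promoted : ∀ {k} {Γ : Sequent k} {R U A} → U ∋ R → Introduced Γ (⟦ R ⟧ bang U A) → All IsWhyNot Γ × (⊢ Γ ++ [ ⟦ R ⟧ A ])
  promoted R∈U (bangP ws _ d) = ws , d
  promoted R∈U (bangW R∉U _) = ⊥-elim (R∉U R∈U)
  promoted R∈U (bangD R∉U _) = ⊥-elim (R∉U R∈U)
  promoted R∈U (bangC R∉U _) = ⊥-elim (R∉U R∈U)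

  ⊢-instantiate : ∀ {k} (t : Term k) {Γ R A} → ⊢ wkS Γ ++ [ ⟦ R ⟧ A ] → ⊢ Γ ++ [ ⟦ R ⟧ inst A t ]
  ⊢-instantiate t {Γ} {R} {A} d =
    subst₂ (λ Δ B → ⊢ Δ ++ [ ⟦ R ⟧ B ]) (subS-instσ-wkS t Γ) (sym (inst-instσ A t)) (⊢-sub-∷ʳ (instσ t) d)

  ⊢-assocʳ : ∀ {k} (Γ Δ : Sequent k) {y} → ⊢ (Γ ++ Δ) ++ [ y ] → ⊢ Γ ++ Δ ++ [ y ]
  ⊢-assocʳ Γ Δ = subst ⊢_ (++-assoc Γ Δ _)

  ⊢-assocˡ : ∀ {k} (Γ Δ : Sequent k) {y} → ⊢ Γ ++ Δ ++ [ y ] → ⊢ (Γ ++ Δ) ++ [ y ]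
  ⊢-assocˡ Γ Δ = subst ⊢_ (sym (++-assoc Γ Δ _))

  ⊢-assoc-subS : ∀ {k j} (σ : Fin k → Term j) Γ Δ y → ⊢ (Γ ++ subS σ Δ) ++ [ subI σ y ] → ⊢ Γ ++ subS σ (Δ ++ [ y ])
  ⊢-assoc-subS σ Γ Δ y = subst (λ Ξ → ⊢ Γ ++ Ξ) (sym (subS-++ σ Δ [ y ])) ∘ ⊢-assocʳ Γ (subS σ Δ)

  -- The non-atomic formulas whose merge starts by lifting both sides to their introduction
  -- (a !-formula qualifies only if both sides are positive).
  data Compound {k} : Formula k → Subset → Subset → Set₁ where
    neg  : ∀ {f A R₁ R₂} → Compound (neg f A) R₁ R₂
    and  : ∀ {U A B R₁ R₂} → Compound (and U A B) R₁ R₂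
    imp  : ∀ {f U A B R₁ R₂} → Compound (imp f U A B) R₁ R₂
    all  : ∀ {U A R₁ R₂} → Compound (all U A) R₁ R₂
    bang : ∀ {U A R₁ R₂} → U ∋ R₁ → U ∋ R₂ → Compound (bang U A) R₁ R₂

  Compound-sub : ∀ {k j} (σ : Fin k → Term j) {A R₁ R₂} → Compound A R₁ R₂ → Compound (subF σ A) R₁ R₂
  Compound-sub σ neg = neg
  Compound-sub σ and = and
  Compound-sub σ imp = imp
  Compound-sub σ all = all
  Compound-sub σ (bang R₁∈U R₂∈U) = bang R₁∈U R₂∈U

  Compound-¬atom : ∀ {k} {A : Formula k} {a R₁ R₂} → Compound A R₁ R₂ → A ≢ atom a
  Compound-¬atom neg ()
  Compound-¬atom and ()
  Compound-¬atom imp ()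
  Compound-¬atom all ()
  Compound-¬atom (bang _ _) ()

  Compound-¬WhyNotˡ : ∀ {k} {A : Formula k} {R₁ R₂} → Compound A R₁ R₂ → ¬ IsWhyNot (⟦ R₁ ⟧ A)
  Compound-¬WhyNotˡ (bang R₁∈U _) (whyNot R₁∉U) = R₁∉U R₁∈U

  Compound-¬WhyNotʳ : ∀ {k} {A : Formula k} {R₁ R₂} → Compound A R₁ R₂ → ¬ IsWhyNot (⟦ R₂ ⟧ A)
  Compound-¬WhyNotʳ (bang _ R₂∈U) (whyNot R₂∉U) = R₂∉U R₂∈U

  size-nonzero : ∀ {k} (A : Formula k) → ¬ (size A ≤ 0)
  size-nonzero (atom _) ()
  size-nonzero (neg f A) ()
  size-nonzero (and U A B) ()
  size-nonzero (imp f U A B) ()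
  size-nonzero (bang U A) ()
  size-nonzero (all U A) ()

  size-subF-≤ : ∀ {k j m} (σ : Fin k → Term j) A → size A ≤ m → size (subF σ A) ≤ m
  size-subF-≤ σ A = subst (_≤ _) (sym (size-subF σ A))

  bang≢atom : ∀ {k} {U} {A : Formula k} {a} → bang U A ≢ atom a
  bang≢atom ()

  merge-atom-axiom : ∀ {j} {Γ₂ : Sequent j} {m} (p : Rl m) ts {R₁ R₂ L} Qs₁ → IsListPartition (Qs₁ ++ [ R₁ ])
                   → Disjoint (∁ R₁) (∁ R₂) → L ≐ R₁ ∩ R₂ → ⊢ Γ₂ ++ [ ⟦ R₂ ⟧ atom (rel p ts) ]
                   → ⊢ (map (atomI (rel p ts)) Qs₁ ++ Γ₂) ++ [ ⟦ L ⟧ atom (rel p ts) ]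
  merge-atom-axiom {j} {Γ₂} p ts {R₁} {R₂} {L} Qs₁ P₁ dc L≐ d₂ =
    exch (prove 3 (v₀ ⊕ v₁ ⊕ v₂) ((v₁ ⊕ v₀) ⊕ v₂) (Γ₂ ∷ map (atomI (rel p ts)) Qs₁ ∷ [ ⟦ L ⟧ atom (rel p ts) ] ∷ []))
      (replace-single (⟦ R₂ ⟧ atom (rel p ts)) (map (atomI (rel p ts)) Qs₁ ++ [ ⟦ L ⟧ atom (rel p ts) ]) (λ ())
        axiom₂ (λ σ Γ ()) d₂)
    where
      axiom₂ : ∀ {i} (σ : Fin j → Term i) {n} a (Rs : Fin (suc n) → Subset) → IsPartition Rs → ∀ Γ
             → tabulateL (λ i → ⟦ Rs i ⟧ atom a) ↭ Γ ++ [ ⟦ R₂ ⟧ atom (rel p (subTs σ ts)) ]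
             → ⊢ Γ ++ subS σ (map (atomI (rel p ts)) Qs₁ ++ [ ⟦ L ⟧ atom (rel p ts) ])
      axiom₂ σ a Rs part Γ q with Id-split a Rs part Γ _ q
      ... | Qs₂ , _ ∷ [] , P₂ , refl , refl =
        subst (λ Δ → ⊢ map (atomI a) Qs₂ ++ Δ) (sym eq)
          (exch (prove 3 (v₀ ⊕ v₁ ⊕ v₂) (v₁ ⊕ v₂ ⊕ v₀) ([ ⟦ L ⟧ atom a ] ∷ map (atomI a) Qs₂ ∷ map (atomI a) Qs₁ ∷ []))
            (subst ⊢_ (cong (⟦ L ⟧ atom a ∷_) (map-++ (atomI a) Qs₂ Qs₁))
              (⊢-Id-list a (IsListPartition-≐∩ L≐ Qs₁ Qs₂ P₁ P₂ dc))))
        where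
          eq : subS σ (map (atomI (rel p ts)) Qs₁ ++ [ ⟦ L ⟧ atom (rel p ts) ]) ≡ map (atomI a) Qs₁ ++ [ ⟦ L ⟧ atom a ]
          eq = trans (subS-++ σ (map (atomI (rel p ts)) Qs₁) _) (cong (_++ _) (subS-atoms σ p ts Qs₁))

  merge-atom : ∀ {k} {Γ₁ Γ₂ : Sequent k} {m} (p : Rl m) ts {R₁ R₂ L} → Disjoint (∁ R₁) (∁ R₂) → L ≐ R₁ ∩ R₂
             → ⊢ Γ₁ ++ [ ⟦ R₁ ⟧ atom (rel p ts) ] → ⊢ Γ₂ ++ [ ⟦ R₂ ⟧ atom (rel p ts) ]
             → ⊢ (Γ₁ ++ Γ₂) ++ [ ⟦ L ⟧ atom (rel p ts) ]
  merge-atom {k} {Γ₁} {Γ₂} p ts {R₁} {R₂} {L} dc L≐ d₁ d₂ =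
    ⊢-assocˡ Γ₁ Γ₂ (replace-single (⟦ R₁ ⟧ atom (rel p ts)) (Γ₂ ++ [ ⟦ L ⟧ atom (rel p ts) ]) (λ ()) axiom₁ (λ σ Γ ()) d₁)
    where
      axiom₁ : ∀ {j} (σ : Fin k → Term j) {n} a (Rs : Fin (suc n) → Subset) → IsPartition Rs → ∀ Γ
             → tabulateL (λ i → ⟦ Rs i ⟧ atom a) ↭ Γ ++ [ ⟦ R₁ ⟧ atom (rel p (subTs σ ts)) ]
             → ⊢ Γ ++ subS σ (Γ₂ ++ [ ⟦ L ⟧ atom (rel p ts) ])
      axiom₁ σ a Rs part Γ q with Id-split a Rs part Γ _ q
      ... | Qs₁ , _ ∷ [] , P₁ , refl , refl =
        ⊢-assoc-subS σ (map (atomI a) Qs₁) Γ₂ _ (merge-atom-axiom p (subTs σ ts) Qs₁ P₁ dc L≐ (⊢-sub-∷ʳ σ d₂))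

  -- Induction on the size of A rather than on A itself, since the ∀ case merges an instance inst A t.
  -- L need only be extensionally R₁ ∩ R₂ so that the two sides can be exchanged (see the ! case).
  mutual
    merge : ∀ m {k} {Γ₁ Γ₂ : Sequent k} A {R₁ R₂ L} → size A ≤ m → Disjoint (∁ R₁) (∁ R₂) → L ≐ R₁ ∩ R₂
          → ⊢ Γ₁ ++ [ ⟦ R₁ ⟧ A ] → ⊢ Γ₂ ++ [ ⟦ R₂ ⟧ A ] → ⊢ (Γ₁ ++ Γ₂) ++ [ ⟦ L ⟧ A ]
    merge zero A sz _ _ _ _ = ⊥-elim (size-nonzero A sz)
    merge (suc m) (atom (rel p ts)) _ dc L≐ d₁ d₂ = merge-atom p ts dc L≐ d₁ d₂
    merge (suc m) (neg f A) sz dc L≐ d₁ d₂ = merge-compound m _ sz dc L≐ neg d₁ d₂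
    merge (suc m) (and U A B) sz dc L≐ d₁ d₂ = merge-compound m _ sz dc L≐ and d₁ d₂
    merge (suc m) (imp f U A B) sz dc L≐ d₁ d₂ = merge-compound m _ sz dc L≐ imp d₁ d₂
    merge (suc m) (all U A) sz dc L≐ d₁ d₂ = merge-compound m _ sz dc L≐ all d₁ d₂
    merge (suc m) {Γ₁ = Γ₁} {Γ₂} (bang U A) {R₁} {R₂} {L} sz dc L≐ d₁ d₂ with ∋-or-∉ U R₁ | ∋-or-∉ U R₂
    ... | inj₁ R₁∈U | inj₁ R₂∈U = merge-compound m _ sz dc L≐ (bang R₁∈U R₂∈U) d₁ d₂
    ... | inj₂ R₁∉U | inj₁ R₂∈U = merge-mixed m U A (≤-pred sz) dc L≐ R₁∉U R₂∈U d₁ d₂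
    ... | inj₁ R₁∈U | inj₂ R₂∉U =
      exch (prove 3 ((v₀ ⊕ v₁) ⊕ v₂) ((v₁ ⊕ v₀) ⊕ v₂) (Γ₂ ∷ Γ₁ ∷ [ ⟦ L ⟧ bang U A ] ∷ []))
        (merge-mixed m U A (≤-pred sz) (Disjoint-sym dc) (≐∩-comm L≐) R₂∉U R₁∈U d₂ d₁)
    ... | inj₂ R₁∉U | inj₂ R₂∉U = ⊥-elim (not-both-∉ U dc R₁∉U R₂∉U)

    merge-compound : ∀ m {k} {Γ₁ Γ₂ : Sequent k} A {R₁ R₂ L} → size A ≤ suc m → Disjoint (∁ R₁) (∁ R₂) → L ≐ R₁ ∩ R₂
                   → Compound A R₁ R₂ → ⊢ Γ₁ ++ [ ⟦ R₁ ⟧ A ] → ⊢ Γ₂ ++ [ ⟦ R₂ ⟧ A ] → ⊢ (Γ₁ ++ Γ₂) ++ [ ⟦ L ⟧ A ]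
    merge-compound m {k} {Γ₁} {Γ₂} A {R₁} {R₂} {L} sz dc L≐ c d₁ d₂ =
      ⊢-assocˡ Γ₁ Γ₂ (replace-single (⟦ R₁ ⟧ A) (Γ₂ ++ [ ⟦ L ⟧ A ]) (⊥-elim ∘ Compound-¬WhyNotˡ c)
        (λ σ a Rs part Γ q → ⊥-elim (Compound-¬atom (Compound-sub σ c) (axiom-atomic a Rs part Γ q)))
        (λ σ Γ₀ I₁ → ⊢-assoc-subS σ Γ₀ Γ₂ _
           (merge-introducedˡ m (subF σ A) (size-subF-≤ σ A sz) dc L≐ (Compound-sub σ c) I₁ (⊢-sub-∷ʳ σ d₂)))
        d₁)

    merge-introducedˡ : ∀ m {k} {Γ₀ Γ₂ : Sequent k} A {R₁ R₂ L} → size A ≤ suc m → Disjoint (∁ R₁) (∁ R₂)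
                      → L ≐ R₁ ∩ R₂ → Compound A R₁ R₂ → Introduced Γ₀ (⟦ R₁ ⟧ A) → ⊢ Γ₂ ++ [ ⟦ R₂ ⟧ A ]
                      → ⊢ (Γ₀ ++ Γ₂) ++ [ ⟦ L ⟧ A ]
    merge-introducedˡ m {k} {Γ₀} {Γ₂} A {R₁} {R₂} {L} sz dc L≐ c I₁ d₂ =
      exch (prove 3 (v₀ ⊕ v₁ ⊕ v₂) ((v₁ ⊕ v₀) ⊕ v₂) (Γ₂ ∷ Γ₀ ∷ [ ⟦ L ⟧ A ] ∷ []))
        (replace-single (⟦ R₂ ⟧ A) (Γ₀ ++ [ ⟦ L ⟧ A ]) (⊥-elim ∘ Compound-¬WhyNotʳ c)
          (λ σ a Rs part Γ q → ⊥-elim (Compound-¬atom (Compound-sub σ c) (axiom-atomic a Rs part Γ q)))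
          (λ σ Γ₀' I₂ → ⊢-assoc-subS σ Γ₀' Γ₀ _
             (exch (prove 3 ((v₀ ⊕ v₁) ⊕ v₂) ((v₁ ⊕ v₀) ⊕ v₂) (subS σ Γ₀ ∷ Γ₀' ∷ [ ⟦ L ⟧ subF σ A ] ∷ []))
               (merge-introduced m (subF σ A) (size-subF-≤ σ A sz) dc L≐ (Compound-sub σ c) (Introduced-sub σ I₁) I₂)))
          d₂)

    merge-introduced : ∀ m {k} {Γa Γb : Sequent k} A {R₁ R₂ L} → size A ≤ suc m → Disjoint (∁ R₁) (∁ R₂)
                     → L ≐ R₁ ∩ R₂ → Compound A R₁ R₂ → Introduced Γa (⟦ R₁ ⟧ A) → Introduced Γb (⟦ R₂ ⟧ A)
                     → ⊢ (Γa ++ Γb) ++ [ ⟦ L ⟧ A ]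
    merge-introduced m (neg f A) sz dc L≐ _ (negR e₁) (negR e₂) =
      negR (merge m A (≤-pred sz) (dc ∘ f) (≐∩-preimage L≐ f) e₁ e₂)
    merge-introduced m (and U A B) sz dc L≐ _ I₁ I₂ =
      merge-and m U A B (m⊔n≤o⇒m≤o _ _ (≤-pred sz)) (m⊔n≤o⇒n≤o _ _ (≤-pred sz)) dc L≐ I₁ I₂
    merge-introduced m (imp f U A B) sz dc L≐ _ I₁ I₂ =
      merge-imp m f U A B (m⊔n≤o⇒m≤o _ _ (≤-pred sz)) (m⊔n≤o⇒n≤o _ _ (≤-pred sz)) dc L≐ I₁ I₂
    merge-introduced m (bang U A) sz dc L≐ (bang R₁∈U R₂∈U) I₁ I₂
      with ws₁ , e₁ ← promoted R₁∈U I₁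
      with ws₂ , e₂ ← promoted R₂∈U I₂ =
      bangP (Allₚ.++⁺ ws₁ ws₂) (∋-≐∩ L≐ U R₁∈U R₂∈U) (merge m A (≤-pred sz) dc L≐ e₁ e₂)
    merge-introduced m (all U A) sz dc L≐ _ I₁ I₂ = merge-all m U A (≤-pred sz) dc L≐ I₁ I₂

    merge-and : ∀ m {k} {Γa Γb : Sequent k} U A B {R₁ R₂ L} → size A ≤ m → size B ≤ m → Disjoint (∁ R₁) (∁ R₂)
              → L ≐ R₁ ∩ R₂ → Introduced Γa (⟦ R₁ ⟧ and U A B) → Introduced Γb (⟦ R₂ ⟧ and U A B)
              → ⊢ (Γa ++ Γb) ++ [ ⟦ L ⟧ and U A B ]
    merge-and m U A B szA szB dc L≐ (andP R₁∈U e₁A e₁B) (andP R₂∈U e₂A e₂B) =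
      andP (∋-≐∩ L≐ U R₁∈U R₂∈U) (merge m A szA dc L≐ e₁A e₂A) (merge m B szB dc L≐ e₁B e₂B)
    merge-and m U A B szA szB dc L≐ (andP _ e₁A _) (andN₁ R₂∉U e₂A) =
      andN₁ (∉-≐∩ʳ L≐ U R₂∉U) (merge m A szA dc L≐ e₁A e₂A)
    merge-and m U A B szA szB dc L≐ (andP _ _ e₁B) (andN₂ R₂∉U e₂B) =
      andN₂ (∉-≐∩ʳ L≐ U R₂∉U) (merge m B szB dc L≐ e₁B e₂B)
    merge-and m U A B szA szB dc L≐ (andN₁ R₁∉U e₁A) (andP _ e₂A _) =
      andN₁ (∉-≐∩ˡ L≐ U R₁∉U) (merge m A szA dc L≐ e₁A e₂A)
    merge-and m U A B szA szB dc L≐ (andN₂ R₁∉U e₁B) (andP _ _ e₂B) =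
      andN₂ (∉-≐∩ˡ L≐ U R₁∉U) (merge m B szB dc L≐ e₁B e₂B)
    merge-and m U A B szA szB dc L≐ (andN₁ R₁∉U _) (andN₁ R₂∉U _) = ⊥-elim (not-both-∉ U dc R₁∉U R₂∉U)
    merge-and m U A B szA szB dc L≐ (andN₁ R₁∉U _) (andN₂ R₂∉U _) = ⊥-elim (not-both-∉ U dc R₁∉U R₂∉U)
    merge-and m U A B szA szB dc L≐ (andN₂ R₁∉U _) (andN₁ R₂∉U _) = ⊥-elim (not-both-∉ U dc R₁∉U R₂∉U)
    merge-and m U A B szA szB dc L≐ (andN₂ R₁∉U _) (andN₂ R₂∉U _) = ⊥-elim (not-both-∉ U dc R₁∉U R₂∉U)

    merge-imp : ∀ m {k} {Γa Γb : Sequent k} f U A B {R₁ R₂ L} → size A ≤ m → size B ≤ m → Disjoint (∁ R₁) (∁ R₂)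
              → L ≐ R₁ ∩ R₂ → Introduced Γa (⟦ R₁ ⟧ imp f U A B) → Introduced Γb (⟦ R₂ ⟧ imp f U A B)
              → ⊢ (Γa ++ Γb) ++ [ ⟦ L ⟧ imp f U A B ]
    merge-imp m f U A B {L = L} szA szB dc L≐ (impP {Γ₁} {Γ₂} R₁∈U e₁A e₁B) (impP {Γ₃} {Γ₄} R₂∈U e₂A e₂B) =
      exch (prove 5 (((v₀ ⊕ v₂) ⊕ (v₁ ⊕ v₃)) ⊕ v₄) (((v₀ ⊕ v₁) ⊕ (v₂ ⊕ v₃)) ⊕ v₄)
                    (Γ₁ ∷ Γ₂ ∷ Γ₃ ∷ Γ₄ ∷ [ ⟦ L ⟧ imp f U A B ] ∷ []))
        (impP (∋-≐∩ L≐ U R₁∈U R₂∈U) (merge m A szA (dc ∘ f) (≐∩-preimage L≐ f) e₁A e₂A) (merge m B szB dc L≐ e₁B e₂B))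
    merge-imp m f U A B {R₁} {L = L} szA szB dc L≐ (impN {Γa} R₁∉U e₁) (impP {Γ₃} {Γ₄} _ e₂A e₂B) =
      impN (∉-≐∩ˡ L≐ U R₁∉U)
        (exch (prove 5 (((v₀ ⊕ v₁ ⊕ v₂) ⊕ v₃) ⊕ v₄) ((v₀ ⊕ v₃ ⊕ v₁) ⊕ (v₄ ⊕ v₂))
                       (Γa ∷ Γ₄ ∷ [ ⟦ L ⟧ B ] ∷ Γ₃ ∷ [ ⟦ preimage f L ⟧ A ] ∷ []))
          (merge m A szA (dc ∘ f) (≐∩-preimage L≐ f)
            (exch (prove 4 (((v₀ ⊕ v₁) ⊕ v₂) ⊕ v₃) ((v₀ ⊕ v₂ ⊕ v₃) ⊕ v₁) (Γa ∷ [ ⟦ preimage f R₁ ⟧ A ] ∷ Γ₄ ∷ [ ⟦ L ⟧ B ] ∷ []))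
              (merge m B szB dc L≐ (⊢-assocˡ Γa [ ⟦ preimage f R₁ ⟧ A ] e₁) e₂B))
            e₂A))
    merge-imp m f U A B {R₂ = R₂} {L} szA szB dc L≐ (impP {Γ₁} {Γ₂} _ e₁A e₁B) (impN {Γb} R₂∉U e₂) =
      impN (∉-≐∩ʳ L≐ U R₂∉U)
        (exch (prove 5 ((v₀ ⊕ v₁ ⊕ v₂ ⊕ v₃) ⊕ v₄) (((v₀ ⊕ v₁) ⊕ v₂) ⊕ (v₄ ⊕ v₃))
                       (Γ₁ ∷ Γ₂ ∷ Γb ∷ [ ⟦ L ⟧ B ] ∷ [ ⟦ preimage f L ⟧ A ] ∷ []))
          (merge m A szA (dc ∘ f) (≐∩-preimage L≐ f) e₁A
            (exch (prove 4 ((v₀ ⊕ v₁ ⊕ v₂) ⊕ v₃) ((v₀ ⊕ v₁ ⊕ v₃) ⊕ v₂) (Γ₂ ∷ Γb ∷ [ ⟦ preimage f R₂ ⟧ A ] ∷ [ ⟦ L ⟧ B ] ∷ []))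
              (merge m B szB dc L≐ e₁B (⊢-assocˡ Γb [ ⟦ preimage f R₂ ⟧ A ] e₂)))))
    merge-imp m f U A B szA szB dc L≐ (impN R₁∉U _) (impN R₂∉U _) = ⊥-elim (not-both-∉ U dc R₁∉U R₂∉U)

    merge-all : ∀ m {k} {Γa Γb : Sequent k} U A {R₁ R₂ L} → size A ≤ m → Disjoint (∁ R₁) (∁ R₂) → L ≐ R₁ ∩ R₂
              → Introduced Γa (⟦ R₁ ⟧ all U A) → Introduced Γb (⟦ R₂ ⟧ all U A) → ⊢ (Γa ++ Γb) ++ [ ⟦ L ⟧ all U A ]
    merge-all m {Γa = Γa} {Γb} U A {L = L} sz dc L≐ (allP R₁∈U e₁) (allP R₂∈U e₂) =
      allP (∋-≐∩ L≐ U R₁∈U R₂∈U) (subst (λ Δ → ⊢ Δ ++ [ ⟦ L ⟧ A ]) (sym (map-++ wkI Γa Γb)) (merge m A sz dc L≐ e₁ e₂))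
    merge-all m U A sz dc L≐ (allN R₁∉U t e₁) (allP _ e₂) =
      allN (∉-≐∩ˡ L≐ U R₁∉U) t (merge m (inst A t) (size-subF-≤ _ A sz) dc L≐ e₁ (⊢-instantiate t e₂))
    merge-all m U A sz dc L≐ (allP _ e₁) (allN R₂∉U t e₂) =
      allN (∉-≐∩ʳ L≐ U R₂∉U) t (merge m (inst A t) (size-subF-≤ _ A sz) dc L≐ (⊢-instantiate t e₁) e₂)
    merge-all m U A sz dc L≐ (allN R₁∉U _ _) (allN R₂∉U _ _) = ⊥-elim (not-both-∉ U dc R₁∉U R₂∉U)

    merge-mixed : ∀ m {k} {Γ₁ Γ₂ : Sequent k} U A {R₁ R₂ L} → size A ≤ m → Disjoint (∁ R₁) (∁ R₂) → L ≐ R₁ ∩ R₂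
                → ¬ (U ∋ R₁) → U ∋ R₂ → ⊢ Γ₁ ++ [ ⟦ R₁ ⟧ bang U A ] → ⊢ Γ₂ ++ [ ⟦ R₂ ⟧ bang U A ]
                → ⊢ (Γ₁ ++ Γ₂) ++ [ ⟦ L ⟧ bang U A ]
    merge-mixed m {k} {Γ₁} {Γ₂} U A {R₁} {R₂} {L} sz dc L≐ R₁∉U R₂∈U d₁ d₂ =
      exch (prove 3 (v₀ ⊕ v₁ ⊕ v₂) ((v₁ ⊕ v₀) ⊕ v₂) (Γ₂ ∷ Γ₁ ∷ [ ⟦ L ⟧ bang U A ] ∷ []))
        (replace-single (⟦ R₂ ⟧ bang U A) (Γ₁ ++ [ ⟦ L ⟧ bang U A ]) (λ { (whyNot R₂∉U) → ⊥-elim (R₂∉U R₂∈U) })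
          (λ σ a Rs part Γ q → ⊥-elim (bang≢atom (axiom-atomic a Rs part Γ q)))
          (λ σ Γ₀ I → let ws , e = promoted R₂∈U I in
             ⊢-assoc-subS σ Γ₀ Γ₁ _
               (exch (prove 3 ((v₀ ⊕ v₁) ⊕ v₂) ((v₁ ⊕ v₀) ⊕ v₂) (subS σ Γ₁ ∷ Γ₀ ∷ [ ⟦ L ⟧ bang U (subF σ A) ] ∷ []))
                 (merge-promoted m (subF σ A) U (size-subF-≤ σ A sz) dc L≐ R₁∉U ws e (⊢-sub-∷ʳ σ d₁))))
          d₂)

    -- All occurrences of [ R₁ ] (! A) are replaced together, as contraction may have duplicated it.
    merge-promoted : ∀ m {k} {Γn Γp : Sequent k} A U {R₁ R₂ L} → size A ≤ m → Disjoint (∁ R₁) (∁ R₂) → L ≐ R₁ ∩ R₂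
                   → ¬ (U ∋ R₁) → All IsWhyNot Γp → ⊢ Γp ++ [ ⟦ R₂ ⟧ A ]
                   → ⊢ Γn ++ [ ⟦ R₁ ⟧ bang U A ] → ⊢ (Γn ++ Γp) ++ [ ⟦ L ⟧ bang U A ]
    merge-promoted m {k} {Γn} {Γp} A U {R₁} {R₂} {L} sz dc L≐ R₁∉U wsp dp dn =
      ⊢-assocˡ Γn Γp (subst ⊢_ (cong (Γn ++_) (trans (++-identityʳ _) (subS-var E)))
        (replace axiom principal var dn Γn [ x ] ↭-refl (sym (subI-var x) ∷ [])))
      where
        x : IFormula k
        x = ⟦ R₁ ⟧ bang U A

        E : Sequent k
        E = Γp ++ [ ⟦ L ⟧ bang U A ]

        E-WhyNot : All IsWhyNot E
        E-WhyNot = Allₚ.++⁺ wsp (whyNot (∉-≐∩ˡ L≐ U R₁∉U) ∷ [])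

        CopiesOfX : ∀ {j} → (Fin k → Term j) → Sequent j → Set₁
        CopiesOfX σ = All (_≡ subI σ x)

        CopiesOfX-wk : ∀ {j} {σ : Fin k → Term j} {Θ} → CopiesOfX σ Θ → CopiesOfX (wkσ σ) (wkS Θ)
        CopiesOfX-wk [] = []
        CopiesOfX-wk {σ = σ} (refl ∷ cs) = wkI-subI σ x ∷ CopiesOfX-wk cs

        open Replacement E CopiesOfX (λ q → ↭.All-resp-↭ q) (λ Θa _ → Allₚ.++⁻ Θa) CopiesOfX-wk
                         (λ {_} {σ} _ _ → subS-WhyNot σ E-WhyNot)

        axiom : ∀ {j} (σ : Fin k → Term j) {n} a (Rs : Fin (suc n) → Subset) → IsPartition Rs → ∀ Γ Θ
              → tabulateL (λ i → ⟦ Rs i ⟧ atom a) ↭ Γ ++ Θ → CopiesOfX σ Θ → ⊢ Γ ++ Replaced σ Θ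
        axiom σ a Rs part Γ [] q _ = exch q (Id a Rs part)
        axiom σ a Rs part Γ (y ∷ Θ) q (refl ∷ _) with Id-split a Rs part Γ (y ∷ Θ) q
        ... | _ , [] , _ , _ , ()
        ... | _ , _ ∷ _ , _ , _ , ()

        principal : ∀ {j} (σ : Fin k → Term j) Γ Γ₀ y Θ → CopiesOfX σ (y ∷ Θ) → Γ₀ ↭ Γ ++ Θ
                  → Introducedᴿ σ Γ₀ y → ⊢ Γ ++ Replaced σ (y ∷ Θ)
        principal σ Γ Γ₀ _ Θ (refl ∷ cs) q₀ (bangP _ R₁∈U _) = ⊥-elim (R₁∉U R₁∈U)
        principal σ Γ Γ₀ _ Θ (refl ∷ cs) q₀ (bangW _ _ ih) =
          exch (prove 3 ((v₀ ⊕ v₁) ⊕ v₂) (v₀ ⊕ v₂ ⊕ v₁) (Γ ∷ Replaced σ Θ ∷ subS σ E ∷ []))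
            (⊢-weaken-WhyNot (subS-WhyNot σ E-WhyNot) (ih Γ Θ q₀ cs))
        principal σ Γ Γ₀ _ Θ (refl ∷ cs) q₀ (bangD _ _ ih) =
          subst (λ Ξ → ⊢ Γ ++ (Ξ ++ Replaced σ Θ)) (sym (subS-++ σ Γp _))
            (exch (prove 4 (((v₀ ⊕ v₁) ⊕ v₂) ⊕ v₃) (v₀ ⊕ (v₂ ⊕ v₃) ⊕ v₁)
                           (Γ ∷ Replaced σ Θ ∷ subS σ Γp ∷ [ ⟦ L ⟧ bang U (subF σ A) ] ∷ []))
              (bangD (∉-≐∩ˡ L≐ U R₁∉U)
                (merge m (subF σ A) (size-subF-≤ σ A sz) dc L≐
                  (exch (++-swapʳ Γ [ ⟦ R₁ ⟧ subF σ A ] (Replaced σ Θ))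
                    (ih (Γ ++ [ ⟦ R₁ ⟧ subF σ A ]) Θ (↭.++⁺ʳ _ q₀ ⟫ ++-swapʳ Γ Θ _) cs))
                  (⊢-sub-∷ʳ σ dp))))
        principal σ Γ Γ₀ _ Θ (refl ∷ cs) q₀ (bangC _ _ ih) =
          exch (prove 3 ((v₀ ⊕ v₁) ⊕ v₂) (v₀ ⊕ v₂ ⊕ v₁) (Γ ∷ Replaced σ Θ ∷ subS σ E ∷ []))
            (⊢-contract-WhyNot (subS-WhyNot σ E-WhyNot)
              (exch (prove 3 (v₀ ⊕ v₂ ⊕ v₂ ⊕ v₁) ((v₀ ⊕ v₁) ⊕ v₂ ⊕ v₂) (Γ ∷ Replaced σ Θ ∷ subS σ E ∷ []))
                (ih Γ (subI σ x ∷ subI σ x ∷ Θ)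
                  (↭.++⁺ʳ _ q₀ ⟫ prove 3 ((v₀ ⊕ v₁) ⊕ v₂) (v₀ ⊕ v₂ ⊕ v₁) (Γ ∷ Θ ∷ (subI σ x ∷ subI σ x ∷ []) ∷ []))
                  (refl ∷ refl ∷ cs))))

  -- The multiparty cut

  ⋂ : ∀ {n} → (Fin (suc n) → Subset) → Subset
  ⋂ {zero} Rs = Rs zero
  ⋂ {suc n} Rs = Rs zero ∩ ⋂ (Rs ∘ suc)

  ⋂-⊆ : ∀ {n} (Rs : Fin (suc n) → Subset) i → ⋂ Rs ⊆ Rs i
  ⋂-⊆ {zero} Rs zero r∈⋂ = r∈⋂
  ⋂-⊆ {suc n} Rs zero (r∈R₀ , _) = r∈R₀
  ⋂-⊆ {suc n} Rs (suc i) (_ , r∈⋂) = ⋂-⊆ (Rs ∘ suc) i r∈⋂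

  ¬¬-⋂ : ∀ {n} (Rs : Fin (suc n) → Subset) r → (∀ i → ¬ ¬ Rs i r) → ¬ ¬ ⋂ Rs r
  ¬¬-⋂ {zero} Rs r h = h zero
  ¬¬-⋂ {suc n} Rs r h r∉⋂ = h zero λ r∈R₀ → ¬¬-⋂ (Rs ∘ suc) r (h ∘ suc) λ r∈⋂ → r∉⋂ (r∈R₀ , r∈⋂)

  merge-family : ∀ {k} n (Rs : Fin (suc n) → Subset) (Γs : Fin (suc n) → Sequent k) A
               → (∀ i j → i ≢ j → Disjoint (∁ (Rs i)) (∁ (Rs j)))
               → (∀ i → ⊢ Γs i ++ [ ⟦ Rs i ⟧ A ]) → ⊢ concat (tabulateL Γs) ++ [ ⟦ ⋂ Rs ⟧ A ]
  merge-family zero Rs Γs A _ ds = subst (λ Δ → ⊢ Δ ++ [ ⟦ Rs zero ⟧ A ]) (sym (++-identityʳ (Γs zero))) (ds zero)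
  merge-family (suc n) Rs Γs A dc ds =
    merge (size A) A ≤-refl dc₀ ≐-refl (ds zero)
      (merge-family n (Rs ∘ suc) (Γs ∘ suc) A (λ i j i≢j → dc (suc i) (suc j) (i≢j ∘ suc-injective)) (ds ∘ suc))
    where
      dc₀ : Disjoint (∁ (Rs zero)) (∁ (⋂ (Rs ∘ suc)))
      dc₀ r r∉R₀ = ¬¬-⋂ (Rs ∘ suc) r (λ i r∉Rᵢ → dc zero (suc i) (λ ()) r r∉R₀ r∉Rᵢ)

  multiparty-cut : Role → ∀ {k} n (Rs : Fin (suc n) → Subset) (Γs : Fin (suc n) → Sequent k) A
                 → IsPartition (λ i → ∁ (Rs i)) → (∀ i → ⊢ Γs i ++ [ ⟦ Rs i ⟧ A ]) → ⊢ concat (tabulateL Γs)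
  multiparty-cut r₀ n Rs Γs A (disj , cover) ds = Erasure.erase r₀ ⋂-empty (merge-family n Rs Γs A disj ds)
    where
      ⋂-empty : Empty (⋂ Rs)
      ⋂-empty r r∈⋂ = proj₂ (cover r) (⋂-⊆ Rs (proj₁ (cover r)) r∈⋂)

lemma12 : (Role : Set) (Fn Rl : ℕ → Set) → Role →
    let open LMRL Role Fn Rl in
    ∀ {k : ℕ} (n : ℕ) (Rs : Fin (suc n) → Subset) (Γs : Fin (suc n) → Sequent k) (A : Formula k)
      → IsPartition (λ i → ∁ (Rs i))
      → (∀ i → ⊢ Γs i ++ [ ⟦ Rs i ⟧ A ])
      → ⊢ concat (tabulateL Γs)
lemma12 Role Fn Rl = MultipartyCut.multiparty-cut Role Fn Rl
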